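{- For every integer $n\geqslant 1$, $$C_n(x)=nxC_{n-1}(x)+\sum_{r=1}^{n-1}\binom{n}{n-r+1}C_{n-r}(x)C_{r-1}(x).$$ When $x=1$ this reduces to $$(2n-1)!!=n\,(2n-3)!!+\sum_{r=1}^{n-1}\binom{n}{n-r+1}(2n-2r-1)!!\,(2r-3)!!,$$ with the convention $(-1)!!=1$.
   Context: For $n\geqslant 1$, $\mathcal{Q}_n$ denotes the set of Stirling permutations of the multiset $\{1,1,2,2,\ldots,n,n\}$, i.e. words $\sigma=\sigma_1\cdots\sigma_{2n}$ using each of $1,\ldots,n$ exactly twice such that for each $i$ all letters between the two occurrences of $i$ are at least $i$. Set $\sigma_0=\sigma_{2n+1}=0$, and let ${\rm des}(\sigma)=\#\{i\in\{0,1,\ldots,2n\}:\sigma_i>\sigma_{i+1}\}$. The second-order Eulerian polynomials are $C_n(x)=\sum_{\sigma\in\mathcal{Q}_n}x^{{\rm des}(\sigma)}$ for $n\geqslant1$, and $C_0(x)=1$. One has $C_n(1)=(2n-1)!!$. -}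

module Defs where

open import Data.Bool using (Bool; true; false; _∧_; if_then_else_)
open import Data.Nat using (ℕ; zero; suc; _+_; _*_; _∸_; _≡ᵇ_; _≤ᵇ_; _<ᵇ_)
open import Data.List using (List; []; _∷_; _++_; [_]; length; map; concatMap; filterᵇ; upTo)
open import Data.Nat.ListAction using (sum)

allᵇ : {A : Set} → (A → Bool) → List A → Bool
allᵇ p []      = true
allᵇ p (x ∷ xs) = p x ∧ allᵇ p xs

anyᵇ : {A : Set} → (A → Bool) → List A → Bool
anyᵇ p []      = false
anyᵇ p (x ∷ xs) = if p x then true else anyᵇ p xs

beforeNext : ℕ → List ℕ → List ℕ
beforeNext a []      = []
beforeNext a (b ∷ w) = if a ≡ᵇ b then [] else b ∷ beforeNext a w
open import Data.Nat.Combinatorics using (_C_)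

words : ℕ → ℕ → List (List ℕ)
words n zero    = [] ∷ []
words n (suc L) = concatMap (λ a → map (a ∷_) (words n L)) (map suc (upTo n))

occ : ℕ → List ℕ → ℕ
occ a []      = 0
occ a (b ∷ w) = if a ≡ᵇ b then suc (occ a w) else occ a w

eachTwice : ℕ → List ℕ → Bool
eachTwice n w = allᵇ (λ i → occ i w ≡ᵇ 2) (map suc (upTo n))

stirlingGaps : List ℕ → Bool
stirlingGaps []      = true
stirlingGaps (a ∷ w) =
  (if anyᵇ (λ b → a ≡ᵇ b) w
     then allᵇ (λ b → a ≤ᵇ b) (beforeNext a w)
     else true)
  ∧ stirlingGaps w

-- σ ∈ 𝒬_n  (σ assumed a word of length 2n over {1,…,n})
isStirling : ℕ → List ℕ → Bool
isStirling n w = eachTwice n w ∧ stirlingGaps w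

Q : ℕ → List (List ℕ)
Q n = filterᵇ (isStirling n) (words n (2 * n))

descents : List ℕ → ℕ
descents []            = 0
descents (a ∷ [])      = 0
descents (a ∷ b ∷ w)   = (if b <ᵇ a then 1 else 0) + descents (b ∷ w)

des : List ℕ → ℕ
des σ = descents (0 ∷ σ ++ [ 0 ])

Poly : Set
Poly = ℕ → ℕ

Ccoef : ℕ → Poly
Ccoef zero zero    = 1
Ccoef zero (suc k) = 0
Ccoef (suc m) k    = length (filterᵇ (λ σ → des σ ≡ᵇ k) (Q (suc m)))

xmul : Poly → Poly
xmul f zero    = 0
xmul f (suc k) = f k

scal : ℕ → Poly → Poly
scal c f k = c * f k

_⊕_ : Poly → Poly → Poly
(f ⊕ g) k = f k + g k

_⊛_ : Poly → Poly → Poly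
(f ⊛ g) k = sum (map (λ i → f i * g (k ∸ i)) (upTo (suc k)))

ΣP : ℕ → (ℕ → Poly) → Poly
ΣP zero    F = λ _ → 0
ΣP (suc m) F = ΣP m F ⊕ F (suc m)

Σℕ : ℕ → (ℕ → ℕ) → ℕ
Σℕ m f = sum (map (λ r → f (suc r)) (upTo m))

-- odd double factorial: oddDF m = (2m-1)!!, with oddDF 0 = (-1)!! = 1
oddDF : ℕ → ℕ
oddDF zero    = 1
oddDF (suc m) = (2 * m + 1) * oddDF m

-- Inserting the block (n+1)(n+1) into the 2n+1 gaps of a Stirling permutation of order n
-- produces every Stirling permutation of order n+1 exactly once, and an insertion keeps the
-- number of descents exactly when the gap is a descent. This gives the triangle recurrence
-- C_{n+1} = (2n+1) x C_n + δ C_n with δ = x (1 - x) d/dx. Since δ is a derivation of the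
-- Cauchy product, Pascal's rule turns the binomial convolution S_n = Σ_j C(n,j) C_{n-1-j} C_j
-- into S_{n+1} = δ S_n + 2n x S_n + C_n, and induction gives S_n = C_n + n (1 - x) C_{n-1};
-- splitting off the term j = n - 1 yields the recurrence. The identity for (2n-1)!! is the
-- same computation at x = 1, where δ vanishes: T_n = Σ_j C(n,j) (2n-2j-3)!! (2j-1)!!
-- satisfies T_{n+1} = 2n T_n + (2n-1)!!, hence T_n = (2n-1)!!.
module Submission where

open import Data.Nat.Base using (ℕ)
open import Defs using (Poly)

open import Algebra.Bundles using (CommutativeSemiring)

module FiniteSum {c ℓ} (R : CommutativeSemiring c ℓ) where

  open CommutativeSemiring R
  open import Algebra.Properties.CommutativeSemigroup +-commutativeSemigroup using (interchange)
  open import Data.Nat.Base using (zero; suc; _<_)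
  open import Data.Nat.Properties using (m<n⇒m<1+n; n<1+n)
  open import Relation.Binary.Reasoning.Setoid setoid

  ∑ : ℕ → (ℕ → Carrier) → Carrier
  ∑ zero    f = 0#
  ∑ (suc n) f = ∑ n f + f n

  ∑-cong : ∀ n {f g : ℕ → Carrier} → (∀ i → i < n → f i ≈ g i) → ∑ n f ≈ ∑ n g
  ∑-cong zero    f≈g = refl
  ∑-cong (suc n) f≈g = +-cong (∑-cong n (λ i i<n → f≈g i (m<n⇒m<1+n i<n))) (f≈g n (n<1+n n))

  ∑-distrib-+ : ∀ n (f g : ℕ → Carrier) → ∑ n (λ i → f i + g i) ≈ ∑ n f + ∑ n g
  ∑-distrib-+ zero    f g = sym (+-identityˡ 0#)
  ∑-distrib-+ (suc n) f g = begin
    ∑ n (λ i → f i + g i) + (f n + g n) ≈⟨ +-congʳ (∑-distrib-+ n f g) ⟩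
    ∑ n f + ∑ n g + (f n + g n)         ≈⟨ interchange (∑ n f) (∑ n g) (f n) (g n) ⟩
    ∑ n f + f n + (∑ n g + g n)         ∎

  ∑-distribˡ-* : ∀ n a (f : ℕ → Carrier) → ∑ n (λ i → a * f i) ≈ a * ∑ n f
  ∑-distribˡ-* zero    a f = sym (zeroʳ a)
  ∑-distribˡ-* (suc n) a f = begin
    ∑ n (λ i → a * f i) + a * f n ≈⟨ +-congʳ (∑-distribˡ-* n a f) ⟩
    a * ∑ n f + a * f n           ≈⟨ sym (distribˡ a (∑ n f) (f n)) ⟩
    a * (∑ n f + f n)             ∎

  ∑-unfoldˡ : ∀ n (f : ℕ → Carrier) → ∑ (suc n) f ≈ f 0 + ∑ n (λ i → f (suc i))
  ∑-unfoldˡ zero    f = +-comm 0# (f 0)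
  ∑-unfoldˡ (suc n) f = begin
    ∑ (suc n) f + f (suc n)                   ≈⟨ +-congʳ (∑-unfoldˡ n f) ⟩
    f 0 + ∑ n (λ i → f (suc i)) + f (suc n)   ≈⟨ +-assoc (f 0) _ _ ⟩
    f 0 + (∑ n (λ i → f (suc i)) + f (suc n)) ∎

  ∑-zero : ∀ n → ∑ n (λ _ → 0#) ≈ 0#
  ∑-zero zero    = refl
  ∑-zero (suc n) = trans (+-identityʳ (∑ n (λ _ → 0#))) (∑-zero n)

import Data.Nat.Properties as ℕP
import Data.Integer.Properties as ℤP

module ℕSum = FiniteSum ℕP.+-*-commutativeSemiring
module ℤSum = FiniteSum ℤP.+-*-commutativeSemiring

module CoefficientPolynomials where

  open import Data.Nat.Base using (zero; suc; _+_; _*_; _∸_; _<_)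
  open import Data.Nat.Properties using (+-identityʳ; *-identityˡ)
  open import Data.List.Base using (map; upTo; [_]; _++_)
  open import Data.List.Properties using (upTo-∷ʳ; map-++)
  open import Data.Nat.ListAction using (sum)
  open import Data.Nat.ListAction.Properties using (sum-++)
  open import Function.Base using (_∘′_)
  open import Relation.Binary.PropositionalEquality hiding ([_])
  open import Defs using (ΣP; _⊛_)
  open ℕSum

  sum-map-upTo : ∀ n (f : ℕ → ℕ) → sum (map f (upTo n)) ≡ ∑ n f
  sum-map-upTo zero    f = refl
  sum-map-upTo (suc n) f = begin
    sum (map f (upTo (suc n)))       ≡⟨ cong (sum ∘′ map f) (sym (upTo-∷ʳ n)) ⟩
    sum (map f (upTo n ++ [ n ]))    ≡⟨ cong sum (map-++ f (upTo n) [ n ]) ⟩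
    sum (map f (upTo n) ++ [ f n ])  ≡⟨ sum-++ (map f (upTo n)) [ f n ] ⟩
    sum (map f (upTo n)) + (f n + 0) ≡⟨ cong₂ _+_ (sum-map-upTo n f) (+-identityʳ (f n)) ⟩
    ∑ n f + f n                      ∎
    where open ≡-Reasoning

  ΣP-∑ : ∀ n (F : ℕ → Poly) k → ΣP n F k ≡ ∑ n (λ j → F (suc j) k)
  ΣP-∑ zero    F k = refl
  ΣP-∑ (suc n) F k = cong (_+ F (suc n) k) (ΣP-∑ n F k)

  ⊛-identityˡ : ∀ {e} → e 0 ≡ 1 → (∀ i → e (suc i) ≡ 0) → ∀ g k → (e ⊛ g) k ≡ g k
  ⊛-identityˡ {e} e0≡1 e[1+i]≡0 g k = begin
    (e ⊛ g) k                                         ≡⟨ sum-map-upTo (suc k) _ ⟩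
    ∑ (suc k) (λ i → e i * g (k ∸ i))                 ≡⟨ ∑-unfoldˡ k _ ⟩
    e 0 * g k + ∑ k (λ i → e (suc i) * g (k ∸ suc i)) ≡⟨ cong₂ _+_ (cong (_* g k) e0≡1) (∑-cong k vanish) ⟩
    1 * g k + ∑ k (λ _ → 0)                           ≡⟨ cong₂ _+_ (*-identityˡ (g k)) (∑-zero k) ⟩
    g k + 0                                           ≡⟨ +-identityʳ (g k) ⟩
    g k                                               ∎
    where
    open ≡-Reasoning
    vanish : ∀ i → i < k → e (suc i) * g (k ∸ suc i) ≡ 0
    vanish i _ = cong (_* g (k ∸ suc i)) (e[1+i]≡0 i)

module BinomialConvolution where

  open import Data.Nat.Base using (suc; _+_; _*_; _∸_; _≤_; _<_)
  open import Data.Nat.Properties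
  open import Data.Nat.Combinatorics using (_C_; nC1≡n; nCn≡1; nCk≡nC[n∸k]; nCk+nC[k+1]≡[n+1]C[k+1])
  open import Relation.Binary.PropositionalEquality
  open import Algebra.Properties.CommutativeSemigroup +-commutativeSemigroup using (x∙yz≈xz∙y; xy∙z≈xz∙y)
  open import Algebra.Properties.CommutativeSemigroup *-commutativeSemigroup using (x∙yz≈y∙xz)
  open ℕSum

  binomConv : ℕ → (ℕ → ℕ → ℕ) → ℕ
  binomConv n V = ∑ n (λ j → (n C j) * V (n ∸ suc j) j)

  1+[n∸[1+j]+j]≡n : ∀ {n j} → j < n → suc (n ∸ suc j + j) ≡ n
  1+[n∸[1+j]+j]≡n {n} {j} j<n = trans (sym (+-suc (n ∸ suc j) j)) (m∸n+n≡m j<n)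

  [1+n]Cn≡1+n : ∀ n → suc n C n ≡ suc n
  [1+n]Cn≡1+n n = trans (nCk≡nC[n∸k] (n≤1+n n)) (trans (cong (suc n C_) (m+n∸n≡m 1 n)) (nC1≡n (suc n)))

  [1+p]C[p∸j+1]≡[1+p]Cj : ∀ {p j} → j ≤ p → suc p C (p ∸ j + 1) ≡ suc p C j
  [1+p]C[p∸j+1]≡[1+p]Cj {p} {j} j≤p = sym (trans (nCk≡nC[n∸k] (m≤n⇒m≤1+n j≤p))
    (cong (suc p C_) (trans (+-∸-assoc 1 j≤p) (+-comm 1 (p ∸ j)))))

  -- Pascal's rule, summed against V.
  binomConv-suc : ∀ n (V : ℕ → ℕ → ℕ) →
    binomConv (suc n) V ≡ binomConv n (λ a b → V (suc a) b + V a (suc b)) + V 0 n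
  binomConv-suc n V = begin
    binomConv (suc n) V
      ≡⟨ ∑-unfoldˡ n _ ⟩
    1 * V n 0 + ∑ n (λ j → (suc n C suc j) * W j)
      ≡⟨ cong₂ _+_ (*-identityˡ (V n 0)) (∑-cong n (λ j _ → pascal j)) ⟩
    V n 0 + ∑ n (λ j → (n C j) * W j + (n C suc j) * W j)
      ≡⟨ cong (V n 0 +_) (∑-distrib-+ n _ _) ⟩
    V n 0 + (A + B)
      ≡⟨ x∙yz≈xz∙y (V n 0) A B ⟩
    (V n 0 + B) + A
      ≡⟨ cong (_+ A) first+B ⟩
    X + V 0 n + A
      ≡⟨ xy∙z≈xz∙y X (V 0 n) A ⟩
    X + A + V 0 n
      ≡⟨ cong (_+ V 0 n) (sym (∑-distrib-+ n _ _)) ⟩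
    ∑ n (λ j → (n C j) * V (n ∸ j) j + (n C j) * W j) + V 0 n
      ≡⟨ cong (_+ V 0 n) (∑-cong n merge) ⟩
    binomConv n (λ a b → V (suc a) b + V a (suc b)) + V 0 n ∎
    where
    open ≡-Reasoning
    W : ℕ → ℕ
    W j = V (n ∸ suc j) (suc j)
    A B X : ℕ
    A = ∑ n (λ j → (n C j) * W j)
    B = ∑ n (λ j → (n C suc j) * W j)
    X = ∑ n (λ j → (n C j) * V (n ∸ j) j)
    pascal : ∀ j → (suc n C suc j) * W j ≡ (n C j) * W j + (n C suc j) * W j
    pascal j = trans (cong (_* W j) (sym (nCk+nC[k+1]≡[n+1]C[k+1] n j))) (*-distribʳ-+ (W j) (n C j) (n C suc j))
    first+B : V n 0 + B ≡ X + V 0 n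
    first+B = begin
      V n 0 + B                               ≡⟨ cong (_+ B) (sym (*-identityˡ (V n 0))) ⟩
      1 * V n 0 + B                           ≡⟨ sym (∑-unfoldˡ n _) ⟩
      ∑ (suc n) (λ j → (n C j) * V (n ∸ j) j) ≡⟨⟩
      X + (n C n) * V (n ∸ n) n               ≡⟨ cong (X +_) (cong₂ _*_ (nCn≡1 n) (cong (λ m → V m n) (n∸n≡0 n))) ⟩
      X + 1 * V 0 n                           ≡⟨ cong (X +_) (*-identityˡ (V 0 n)) ⟩
      X + V 0 n                               ∎
    merge : ∀ j → j < n → (n C j) * V (n ∸ j) j + (n C j) * W j ≡ (n C j) * (V (suc (n ∸ suc j)) j + W j)
    merge j j<n = trans (sym (*-distribˡ-+ (n C j) _ _)) (cong (λ m → (n C j) * (V m j + W j)) (+-∸-assoc 1 j<n))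

  binomConv-cong : ∀ n {V W : ℕ → ℕ → ℕ} → (∀ a b → suc (a + b) ≡ n → V a b ≡ W a b) →
    binomConv n V ≡ binomConv n W
  binomConv-cong n V≡W = ∑-cong n (λ j j<n → cong ((n C j) *_) (V≡W (n ∸ suc j) j (1+[n∸[1+j]+j]≡n j<n)))

  binomConv-*ˡ : ∀ n m (V : ℕ → ℕ → ℕ) → binomConv n (λ a b → m * V a b) ≡ m * binomConv n V
  binomConv-*ˡ n m V = trans (∑-cong n (λ j _ → x∙yz≈y∙xz (n C j) m _)) (∑-distribˡ-* n m _)

  binomConv-last : ∀ p (V : ℕ → ℕ → ℕ) →
    binomConv (suc p) V ≡ ∑ p (λ j → (suc p C j) * V (p ∸ j) j) + suc p * V 0 p
  binomConv-last p V = cong (∑ p (λ j → (suc p C j) * V (p ∸ j) j) +_)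
    (cong₂ _*_ ([1+n]Cn≡1+n p) (cong (λ m → V m p) (n∸n≡0 p)))

module OddDoubleFactorial where

  open import Data.Nat.Base using (zero; suc; _+_; _*_; _∸_; _<_)
  open import Data.Nat.Properties
  open import Data.Nat.Combinatorics using (_C_)
  open import Data.Nat.Tactic.RingSolver using (solve-∀)
  open import Relation.Binary.PropositionalEquality
  open import Defs using (Σℕ; oddDF)
  open ℕSum
  open CoefficientPolynomials using (sum-map-upTo)
  open BinomialConvolution

  oddDF-pair : ∀ a b →
    oddDF (suc a) * oddDF b + oddDF a * oddDF (suc b) ≡ 2 * suc (a + b) * (oddDF a * oddDF b)
  oddDF-pair a b = identity a b (oddDF a) (oddDF b)
    where
    identity : ∀ a b x y → (2 * a + 1) * x * y + x * ((2 * b + 1) * y) ≡ 2 * suc (a + b) * (x * y)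
    identity = solve-∀

  binomConv-oddDF : ∀ p → binomConv (suc p) (λ a b → oddDF a * oddDF b) ≡ oddDF (suc p)
  binomConv-oddDF zero    = refl
  binomConv-oddDF (suc p) = begin
    binomConv (suc (suc p)) V
      ≡⟨ binomConv-suc (suc p) V ⟩
    binomConv (suc p) (λ a b → V (suc a) b + V a (suc b)) + V 0 (suc p)
      ≡⟨ cong (_+ V 0 (suc p)) (binomConv-cong (suc p) pair) ⟩
    binomConv (suc p) (λ a b → 2 * suc p * V a b) + V 0 (suc p)
      ≡⟨ cong (_+ V 0 (suc p)) (binomConv-*ˡ (suc p) (2 * suc p) V) ⟩
    2 * suc p * binomConv (suc p) V + 1 * oddDF (suc p)
      ≡⟨ cong (λ x → 2 * suc p * x + 1 * oddDF (suc p)) (binomConv-oddDF p) ⟩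
    2 * suc p * oddDF (suc p) + 1 * oddDF (suc p)
      ≡⟨ sym (*-distribʳ-+ (oddDF (suc p)) (2 * suc p) 1) ⟩
    oddDF (suc (suc p)) ∎
    where
    open ≡-Reasoning
    V : ℕ → ℕ → ℕ
    V a b = oddDF a * oddDF b
    pair : ∀ a b → suc (a + b) ≡ suc p → V (suc a) b + V a (suc b) ≡ 2 * suc p * V a b
    pair a b a+b+1≡1+p = trans (oddDF-pair a b) (cong (λ m → 2 * m * V a b) a+b+1≡1+p)

  oddDF-recurrence : ∀ p → oddDF (suc p) ≡ suc p * oddDF p
    + Σℕ p (λ r → (suc p C (suc p ∸ r + 1)) * oddDF (suc p ∸ r) * oddDF (r ∸ 1))
  oddDF-recurrence p = begin
    oddDF (suc p)
      ≡⟨ sym (binomConv-oddDF p) ⟩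
    binomConv (suc p) V
      ≡⟨ binomConv-last p V ⟩
    ∑ p (λ j → (suc p C j) * V (p ∸ j) j) + suc p * (oddDF p + 0)
      ≡⟨ +-comm (∑ p (λ j → (suc p C j) * V (p ∸ j) j)) _ ⟩
    suc p * (oddDF p + 0) + ∑ p (λ j → (suc p C j) * V (p ∸ j) j)
      ≡⟨ cong₂ _+_ (cong (suc p *_) (+-identityʳ (oddDF p))) (∑-cong p reflect) ⟩
    suc p * oddDF p + ∑ p (λ j → (suc p C (p ∸ j + 1)) * oddDF (p ∸ j) * oddDF j)
      ≡⟨ cong (suc p * oddDF p +_) (sym (sum-map-upTo p _)) ⟩
    suc p * oddDF p + Σℕ p (λ r → (suc p C (suc p ∸ r + 1)) * oddDF (suc p ∸ r) * oddDF (r ∸ 1)) ∎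
    where
    open ≡-Reasoning
    V : ℕ → ℕ → ℕ
    V a b = oddDF a * oddDF b
    reflect : ∀ j → j < p → (suc p C j) * V (p ∸ j) j ≡ (suc p C (p ∸ j + 1)) * oddDF (p ∸ j) * oddDF j
    reflect j j<p = trans (cong (_* V (p ∸ j) j) (sym ([1+p]C[p∸j+1]≡[1+p]Cj (<⇒≤ j<p))))
                          (sym (*-assoc (suc p C (p ∸ j + 1)) (oddDF (p ∸ j)) (oddDF j)))

module Series where

  open import Data.Nat.Base as ℕ using (ℕ; zero; suc; _∸_; _<_)
  import Data.Nat.Properties as ℕ
  open import Data.Integer.Base using (ℤ; +_; _+_; _*_; _-_)
  open import Data.Integer.Properties
    using (pos-+; *-assoc; *-zeroʳ; +-identityˡ; +-identityʳ; *-commutativeSemigroup)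
  open import Data.Integer.Tactic.RingSolver using (solve-∀)
  open import Algebra.Properties.CommutativeSemigroup *-commutativeSemigroup using (x∙yz≈y∙xz)
  open import Relation.Binary.PropositionalEquality
  open import Data.Nat.Combinatorics using (_C_)
  open BinomialConvolution using (1+[n∸[1+j]+j]≡n)
  open ℤSum

  ∑-distrib-- : ∀ n (f g : ℕ → ℤ) → ∑ n (λ i → f i - g i) ≡ ∑ n f - ∑ n g
  ∑-distrib-- zero    f g = refl
  ∑-distrib-- (suc n) f g =
    trans (cong (_+ (f n - g n)) (∑-distrib-- n f g)) (interchange (∑ n f) (∑ n g) (f n) (g n))
    where
    interchange : ∀ a b c d → a - b + (c - d) ≡ a + c - (b + d)
    interchange = solve-∀

  Seq : Set
  Seq = ℕ → ℤ

  infixl 6 _⊞_ _⊟_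
  infixl 7 _·_ _∗_

  _⊞_ _⊟_ : Seq → Seq → Seq
  (f ⊞ g) k = f k + g k
  (f ⊟ g) k = f k - g k

  _·_ : ℤ → Seq → Seq
  (a · f) k = a * f k

  _∗_ : Seq → Seq → Seq
  (f ∗ g) k = ∑ (suc k) (λ i → f i * g (k ∸ i))

  shift : Seq → Seq
  shift f zero    = + 0
  shift f (suc k) = f k

  euler : Seq → Seq
  euler f k = + k * f k

  -- δ = x (1 - x) d/dx
  δ : Seq → Seq
  δ f = euler f ⊟ shift (euler f)

  δ-unfold : ∀ f k → δ f k ≡ + k * f k - (+ k - + 1) * shift f k
  δ-unfold f zero    = identity (f 0)
    where
    identity : ∀ a → + 0 * a - + 0 ≡ + 0 * a - (+ 0 - + 1) * + 0
    identity = solve-∀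
  δ-unfold f (suc k) = identity (+ k) (f (suc k)) (f k)
    where
    identity : ∀ K a b → (+ 1 + K) * a - K * b ≡ (+ 1 + K) * a - ((+ 1 + K) - + 1) * b
    identity = solve-∀

  shift-cong : ∀ {f g} → f ≗ g → shift f ≗ shift g
  shift-cong f≗g zero    = refl
  shift-cong f≗g (suc k) = f≗g k

  δ-cong : ∀ {f g} → f ≗ g → δ f ≗ δ g
  δ-cong f≗g k = cong₂ _-_ (cong (+ k *_) (f≗g k)) (shift-cong (λ i → cong (+ i *_) (f≗g i)) k)

  shift-⊞ : ∀ f g → shift (f ⊞ g) ≗ shift f ⊞ shift g
  shift-⊞ f g zero    = refl
  shift-⊞ f g (suc k) = refl

  ∗-congˡ : ∀ {f f'} g → f ≗ f' → f ∗ g ≗ f' ∗ g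
  ∗-congˡ g f≗f' k = ∑-cong (suc k) (λ i _ → cong (_* g (k ∸ i)) (f≗f' i))

  ∗-congʳ : ∀ f {g g'} → g ≗ g' → f ∗ g ≗ f ∗ g'
  ∗-congʳ f g≗g' k = ∑-cong (suc k) (λ i _ → cong (f i *_) (g≗g' (k ∸ i)))

  ∗-distribʳ-⊟ : ∀ f f' g → (f ⊟ f') ∗ g ≗ f ∗ g ⊟ f' ∗ g
  ∗-distribʳ-⊟ f f' g k =
    trans (∑-cong (suc k) (λ i _ → distrib (f i) (f' i) (g (k ∸ i)))) (∑-distrib-- (suc k) _ _)
    where
    distrib : ∀ a b c → (a - b) * c ≡ a * c - b * c
    distrib = solve-∀

  ∗-distribˡ-⊟ : ∀ f g g' → f ∗ (g ⊟ g') ≗ f ∗ g ⊟ f ∗ g'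
  ∗-distribˡ-⊟ f g g' k =
    trans (∑-cong (suc k) (λ i _ → distrib (f i) (g (k ∸ i)) (g' (k ∸ i)))) (∑-distrib-- (suc k) _ _)
    where
    distrib : ∀ a b c → a * (b - c) ≡ a * b - a * c
    distrib = solve-∀

  ∗-·ˡ : ∀ a f g → (a · f) ∗ g ≗ a · (f ∗ g)
  ∗-·ˡ a f g k = trans (∑-cong (suc k) (λ i _ → *-assoc a (f i) (g (k ∸ i)))) (∑-distribˡ-* (suc k) a _)

  ∗-·ʳ : ∀ a f g → f ∗ (a · g) ≗ a · (f ∗ g)
  ∗-·ʳ a f g k = trans (∑-cong (suc k) (λ i _ → x∙yz≈y∙xz (f i) a (g (k ∸ i)))) (∑-distribˡ-* (suc k) a _)

  ∗-shiftˡ : ∀ f g → shift f ∗ g ≗ shift (f ∗ g)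
  ∗-shiftˡ f g zero    = +-identityˡ (+ 0 * g 0)
  ∗-shiftˡ f g (suc k) = trans (∑-unfoldˡ (suc k) _) (+-identityˡ _)

  ∗-shiftʳ : ∀ f g → f ∗ shift g ≗ shift (f ∗ g)
  ∗-shiftʳ f g zero    = trans (+-identityˡ _) (*-zeroʳ (f 0))
  ∗-shiftʳ f g (suc k) = trans (cong₂ _+_ (∑-cong (suc k) inner) last) (+-identityʳ _)
    where
    inner : ∀ i → i < suc k → f i * shift g (suc k ∸ i) ≡ f i * g (k ∸ i)
    inner i i<1+k = cong (λ m → f i * shift g m) (ℕ.+-∸-assoc 1 (ℕ.≤-pred i<1+k))
    last : f (suc k) * shift g (k ∸ k) ≡ + 0
    last = trans (cong (λ m → f (suc k) * shift g m) (ℕ.n∸n≡0 k)) (*-zeroʳ (f (suc k)))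

  euler-∗ : ∀ f g → euler (f ∗ g) ≗ euler f ∗ g ⊞ f ∗ euler g
  euler-∗ f g k = begin
    + k * ∑ (suc k) (λ i → f i * g (k ∸ i))           ≡⟨ sym (∑-distribˡ-* (suc k) (+ k) _) ⟩
    ∑ (suc k) (λ i → + k * (f i * g (k ∸ i)))         ≡⟨ ∑-cong (suc k) (λ i i<1+k → split i (ℕ.≤-pred i<1+k)) ⟩
    ∑ (suc k) (λ i → euler f i * g (k ∸ i) + f i * euler g (k ∸ i))
                                                      ≡⟨ ∑-distrib-+ (suc k) _ _ ⟩
    (euler f ∗ g ⊞ f ∗ euler g) k                     ∎
    where
    open ≡-Reasoning
    identity : ∀ I J a b → (I + J) * (a * b) ≡ I * a * b + a * (J * b)
    identity = solve-∀
    split : ∀ i → i ℕ.≤ k → + k * (f i * g (k ∸ i)) ≡ euler f i * g (k ∸ i) + f i * euler g (k ∸ i)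
    split i i≤k = trans (cong (λ m → + m * (f i * g (k ∸ i))) (sym (ℕ.m+[n∸m]≡n i≤k)))
                        (trans (cong (_* (f i * g (k ∸ i))) (pos-+ i (k ∸ i)))
                               (identity (+ i) (+ (k ∸ i)) (f i) (g (k ∸ i))))

  δ-∗ : ∀ f g → δ (f ∗ g) ≗ δ f ∗ g ⊞ f ∗ δ g
  δ-∗ f g k = begin
    euler (f ∗ g) k - shift (euler (f ∗ g)) k
      ≡⟨ cong₂ _-_ (euler-∗ f g k) (trans (shift-cong (euler-∗ f g) k) (shift-⊞ (f′ ∗ g) (f ∗ g′) k)) ⟩
    (f′ ∗ g) k + (f ∗ g′) k - (shift (f′ ∗ g) k + shift (f ∗ g′) k)
      ≡⟨ cong (λ t → (f′ ∗ g) k + (f ∗ g′) k - t) (sym (cong₂ _+_ (∗-shiftˡ f′ g k) (∗-shiftʳ f g′ k))) ⟩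
    (f′ ∗ g) k + (f ∗ g′) k - ((shift f′ ∗ g) k + (f ∗ shift g′) k)
      ≡⟨ regroup ((f′ ∗ g) k) ((f ∗ g′) k) ((shift f′ ∗ g) k) ((f ∗ shift g′) k) ⟩
    (f′ ∗ g) k - (shift f′ ∗ g) k + ((f ∗ g′) k - (f ∗ shift g′) k)
      ≡⟨ sym (cong₂ _+_ (∗-distribʳ-⊟ f′ (shift f′) g k) (∗-distribˡ-⊟ f g′ (shift g′) k)) ⟩
    (δ f ∗ g ⊞ f ∗ δ g) k ∎
    where
    open ≡-Reasoning
    f′ g′ : Seq
    f′ = euler f
    g′ = euler g
    regroup : ∀ a b c d → a + b - (c + d) ≡ a - c + (b - d)
    regroup = solve-∀

  lincomb : ℕ → (ℕ → ℤ) → (ℕ → Seq) → Seq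
  lincomb n w F k = ∑ n (λ j → w j * F j k)

  lincomb-cong : ∀ n w {F G : ℕ → Seq} → (∀ j → j < n → F j ≗ G j) → lincomb n w F ≗ lincomb n w G
  lincomb-cong n w F≗G k = ∑-cong n (λ j j<n → cong (w j *_) (F≗G j j<n k))

  lincomb-⊞-· : ∀ n w a (F G : ℕ → Seq) →
    lincomb n w (λ j → F j ⊞ a · G j) ≗ lincomb n w F ⊞ a · lincomb n w G
  lincomb-⊞-· n w a F G k = begin
    ∑ n (λ j → w j * (F j k + a * G j k))          ≡⟨ ∑-cong n (λ j _ → distrib (w j) a (F j k) (G j k)) ⟩
    ∑ n (λ j → w j * F j k + a * (w j * G j k))    ≡⟨ ∑-distrib-+ n _ _ ⟩
    lincomb n w F k + ∑ n (λ j → a * (w j * G j k)) ≡⟨ cong (λ t → lincomb n w F k + t) (∑-distribˡ-* n a _) ⟩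
    lincomb n w F k + a * lincomb n w G k           ∎
    where
    open ≡-Reasoning
    distrib : ∀ w a x y → w * (x + a * y) ≡ w * x + a * (w * y)
    distrib = solve-∀

  shift-lincomb : ∀ n w F → shift (lincomb n w F) ≗ lincomb n w (λ j → shift (F j))
  shift-lincomb n w F zero    = sym (trans (∑-cong n (λ j _ → *-zeroʳ (w j))) (∑-zero n))
  shift-lincomb n w F (suc k) = refl

  δ-lincomb : ∀ n w F → δ (lincomb n w F) ≗ lincomb n w (λ j → δ (F j))
  δ-lincomb n w F k = begin
    euler L k - shift (euler L) k
      ≡⟨ cong₂ _-_ (euler-lincomb k) (trans (shift-cong euler-lincomb k) (shift-lincomb n w _ k)) ⟩
    lincomb n w (λ j → euler (F j)) k - lincomb n w (λ j → shift (euler (F j))) k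
      ≡⟨ sym (∑-distrib-- n _ _) ⟩
    ∑ n (λ j → w j * euler (F j) k - w j * shift (euler (F j)) k)
      ≡⟨ ∑-cong n (λ j _ → sym (distrib (w j) _ _)) ⟩
    lincomb n w (λ j → δ (F j)) k ∎
    where
    open ≡-Reasoning
    L : Seq
    L = lincomb n w F
    euler-lincomb : euler L ≗ lincomb n w (λ j → euler (F j))
    euler-lincomb k = trans (sym (∑-distribˡ-* n (+ k) _)) (∑-cong n (λ j _ → x∙yz≈y∙xz (+ k) (w j) (F j k)))
    distrib : ∀ w a b → w * (a - b) ≡ w * a - w * b
    distrib = solve-∀

  binomConvₛ : ℕ → (ℕ → ℕ → Seq) → Seq
  binomConvₛ n W = lincomb n (λ j → + (n C j)) (λ j → W (n ∸ suc j) j)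

  binomConvₛ-cong : ∀ n {V W : ℕ → ℕ → Seq} → (∀ a b → suc (a ℕ.+ b) ≡ n → V a b ≗ W a b) →
    binomConvₛ n V ≗ binomConvₛ n W
  binomConvₛ-cong n V≗W =
    lincomb-cong n (λ j → + (n C j)) (λ j j<n → V≗W (n ∸ suc j) j (1+[n∸[1+j]+j]≡n j<n))

module NatSeries where

  open import Data.Nat.Base using (zero; suc; _∸_)
  open import Data.Integer.Base as ℤ using (+_)
  open import Data.Integer.Properties using (pos-+; pos-*)
  open import Data.Nat.Combinatorics using (_C_)
  open import Relation.Binary.PropositionalEquality
  open import Defs using (Poly; _⊛_; xmul)
  open CoefficientPolynomials using (sum-map-upTo)
  open BinomialConvolution using (binomConv)
  open Series using (Seq; _∗_; shift; binomConvₛ)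

  toSeq : Poly → Seq
  toSeq f k = + f k

  shift-toSeq : ∀ f → shift (toSeq f) ≗ toSeq (xmul f)
  shift-toSeq f zero    = refl
  shift-toSeq f (suc k) = refl

  pos-∑ : ∀ n (f : ℕ → ℕ) → + ℕSum.∑ n f ≡ ℤSum.∑ n (λ i → + f i)
  pos-∑ zero    f = refl
  pos-∑ (suc n) f = trans (pos-+ (ℕSum.∑ n f) (f n)) (cong (ℤ._+ + f n) (pos-∑ n f))

  pos-⊛ : ∀ f g → toSeq (f ⊛ g) ≗ toSeq f ∗ toSeq g
  pos-⊛ f g k = trans (cong +_ (sum-map-upTo (suc k) _))
                      (trans (pos-∑ (suc k) _) (ℤSum.∑-cong (suc k) (λ i _ → pos-* (f i) (g (k ∸ i)))))

  pos-binomConv : ∀ n (V : ℕ → ℕ → Poly) k →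
    + binomConv n (λ a b → V a b k) ≡ binomConvₛ n (λ a b → toSeq (V a b)) k
  pos-binomConv n V k = trans (pos-∑ n _) (ℤSum.∑-cong n (λ j _ → pos-* (n C j) _))

module _ where

  open import Data.Nat.Base using (suc; _+_; _*_)
  open import Relation.Binary.PropositionalEquality using (_≡_)

  -- The triangle recurrence of the second-order Eulerian numbers:
  -- C_{n+1}(x) = (2n+1) x C_n(x) + x (1 - x) C_n'(x), with C_0 = 1.
  record SecondOrderEulerian (c : ℕ → Poly) : Set where
    field
      c₀-zero : c 0 0 ≡ 1
      c₀-suc  : ∀ k → c 0 (suc k) ≡ 0
      c-zero  : ∀ n → c (suc n) 0 ≡ 0
      c-suc   : ∀ n k → c (suc n) (suc k) + k * c n k ≡ suc k * c n (suc k) + (2 * n + 1) * c n k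

module ConvolutionRecurrence {c : ℕ → Poly} (eulerian : SecondOrderEulerian c) where

  open SecondOrderEulerian eulerian
  open import Data.Nat.Base as ℕ using (zero; suc; _∸_)
  import Data.Nat.Properties as ℕ
  open import Data.Integer.Base using (ℤ; +_; _+_; _*_; _-_)
  open import Data.Integer.Properties using (pos-+; pos-*; +-injective)
  open import Data.Integer.Tactic.RingSolver using (solve-∀)
  open import Data.Nat.Combinatorics using (_C_)
  open import Algebra.Properties.CommutativeSemigroup ℕ.+-commutativeSemigroup using (xy∙z≈zx∙y)
  open import Relation.Binary.PropositionalEquality
  open import Defs using (_⊛_; _⊕_; xmul; scal; ΣP)
  open CoefficientPolynomials using (ΣP-∑; ⊛-identityˡ)
  open BinomialConvolution using (binomConv; binomConv-suc; binomConv-last; [1+p]C[p∸j+1]≡[1+p]Cj)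
  open Series
  open NatSeries

  c₀-⊛ : ∀ g k → (c 0 ⊛ g) k ≡ g k
  c₀-⊛ = ⊛-identityˡ {c 0} c₀-zero c₀-suc

  ĉ : ℕ → Seq
  ĉ a = toSeq (c a)

  odd : ℕ → ℤ
  odd a = + a + + a + + 1

  pos-odd : ∀ a → + (2 ℕ.* a ℕ.+ 1) ≡ odd a
  pos-odd a = trans (pos-+ (2 ℕ.* a) 1)
                    (cong (_+ + 1) (trans (cong (λ m → + (a ℕ.+ m)) (ℕ.+-identityʳ a)) (pos-+ a a)))

  odd-+-odd : ∀ {a b n} → suc (a ℕ.+ b) ≡ n → odd a + odd b ≡ + n + + n
  odd-+-odd {a} {b} refl = trans (identity (+ a) (+ b)) (cong (λ t → + 1 + t + (+ 1 + t)) (sym (pos-+ a b)))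
    where
    identity : ∀ A B → A + A + + 1 + (B + B + + 1) ≡ + 1 + (A + B) + (+ 1 + (A + B))
    identity = solve-∀

  ĉ-suc : ∀ a → ĉ (suc a) ≗ odd a · shift (ĉ a) ⊞ δ (ĉ a)
  ĉ-suc a zero    = trans (cong +_ (c-zero a)) (vanish (odd a) (ĉ a 0))
    where
    vanish : ∀ m x → + 0 ≡ m * + 0 + (+ 0 * x - + 0)
    vanish = solve-∀
  ĉ-suc a (suc k) = isolate (ĉ (suc a) (suc k)) (+ k) (ĉ a k) (ĉ a (suc k)) (odd a) cast
    where
    cast : ĉ (suc a) (suc k) + + k * ĉ a k ≡ + suc k * ĉ a (suc k) + odd a * ĉ a k
    cast = begin
      ĉ (suc a) (suc k) + + k * ĉ a k
        ≡⟨ cong (λ t → ĉ (suc a) (suc k) + t) (sym (pos-* k (c a k))) ⟩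
      ĉ (suc a) (suc k) + + (k ℕ.* c a k)
        ≡⟨ sym (pos-+ (c (suc a) (suc k)) (k ℕ.* c a k)) ⟩
      + (c (suc a) (suc k) ℕ.+ k ℕ.* c a k)
        ≡⟨ cong +_ (c-suc a k) ⟩
      + (suc k ℕ.* c a (suc k) ℕ.+ (2 ℕ.* a ℕ.+ 1) ℕ.* c a k)
        ≡⟨ pos-+ (suc k ℕ.* c a (suc k)) _ ⟩
      + (suc k ℕ.* c a (suc k)) + + ((2 ℕ.* a ℕ.+ 1) ℕ.* c a k)
        ≡⟨ cong₂ _+_ (pos-* (suc k) (c a (suc k)))
                     (trans (pos-* (2 ℕ.* a ℕ.+ 1) (c a k)) (cong (_* ĉ a k) (pos-odd a))) ⟩
      + suc k * ĉ a (suc k) + odd a * ĉ a k ∎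
      where open ≡-Reasoning
    isolate : ∀ x K y z m → x + K * y ≡ (+ 1 + K) * z + m * y → x ≡ m * y + ((+ 1 + K) * z - K * y)
    isolate x K y z m eq = trans (cancel x K y) (trans (cong (_- K * y) eq) (rearrange K y z m))
      where
      cancel : ∀ x K y → x ≡ x + K * y - K * y
      cancel = solve-∀
      rearrange : ∀ K y z m → (+ 1 + K) * z + m * y - K * y ≡ m * y + ((+ 1 + K) * z - K * y)
      rearrange = solve-∀

  δ-ĉ : ∀ a → δ (ĉ a) ≗ ĉ (suc a) ⊟ odd a · shift (ĉ a)
  δ-ĉ a k = trans (isolate (odd a * shift (ĉ a) k) (δ (ĉ a) k)) (cong (_- odd a * shift (ĉ a) k) (sym (ĉ-suc a k)))
    where
    isolate : ∀ x y → y ≡ x + y - x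
    isolate = solve-∀

  δ-ĉ₀ : δ (ĉ 0) ≗ λ _ → + 0
  δ-ĉ₀ zero          = refl
  δ-ĉ₀ (suc zero)    rewrite c₀-suc 0 = refl
  δ-ĉ₀ (suc (suc k)) rewrite c₀-suc (suc k) | c₀-suc k = vanish (+ k)
    where
    vanish : ∀ K → (+ 2 + K) * + 0 - (+ 1 + K) * + 0 ≡ + 0
    vanish = solve-∀

  U : ℕ → ℕ → Seq
  U a b = ĉ a ∗ ĉ b

  δ-U : ∀ a b → δ (U a b) ≗ U (suc a) b ⊞ U a (suc b) ⊟ (odd a + odd b) · shift (U a b)
  δ-U a b k = begin
    δ (ĉ a ∗ ĉ b) k
      ≡⟨ δ-∗ (ĉ a) (ĉ b) k ⟩
    (δ (ĉ a) ∗ ĉ b) k + (ĉ a ∗ δ (ĉ b)) k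
      ≡⟨ cong₂ _+_ (∗-congˡ (ĉ b) (δ-ĉ a) k) (∗-congʳ (ĉ a) (δ-ĉ b) k) ⟩
    ((ĉ (suc a) ⊟ xa) ∗ ĉ b) k + (ĉ a ∗ (ĉ (suc b) ⊟ xb)) k
      ≡⟨ cong₂ _+_ (∗-distribʳ-⊟ (ĉ (suc a)) xa (ĉ b) k) (∗-distribˡ-⊟ (ĉ a) (ĉ (suc b)) xb k) ⟩
    U (suc a) b k - (xa ∗ ĉ b) k + (U a (suc b) k - (ĉ a ∗ xb) k)
      ≡⟨ cong₂ (λ x y → U (suc a) b k - x + (U a (suc b) k - y))
               (trans (∗-·ˡ (odd a) (shift (ĉ a)) (ĉ b) k) (cong (odd a *_) (∗-shiftˡ (ĉ a) (ĉ b) k)))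
               (trans (∗-·ʳ (odd b) (ĉ a) (shift (ĉ b)) k) (cong (odd b *_) (∗-shiftʳ (ĉ a) (ĉ b) k))) ⟩
    U (suc a) b k - odd a * shift (U a b) k + (U a (suc b) k - odd b * shift (U a b) k)
      ≡⟨ collect (U (suc a) b k) (U a (suc b) k) (odd a) (odd b) (shift (U a b) k) ⟩
    (U (suc a) b ⊞ U a (suc b) ⊟ (odd a + odd b) · shift (U a b)) k ∎
    where
    open ≡-Reasoning
    xa xb : Seq
    xa = odd a · shift (ĉ a)
    xb = odd b · shift (ĉ b)
    collect : ∀ X Y A B s → X - A * s + (Y - B * s) ≡ X + Y - (A + B) * s
    collect = solve-∀

  S : ℕ → Seq
  S n k = + binomConv n (λ a b → (c a ⊛ c b) k)

  S-binomConvₛ : ∀ n → S n ≗ binomConvₛ n U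
  S-binomConvₛ n k =
    trans (pos-binomConv n (λ a b → c a ⊛ c b) k) (binomConvₛ-cong n (λ a b _ → pos-⊛ (c a) (c b)) k)

  S-suc : ∀ n → S (suc n) ≗ δ (S n) ⊞ (+ n + + n) · shift (S n) ⊞ ĉ n
  S-suc n k = begin
    S (suc n) k
      ≡⟨ cong +_ (binomConv-suc n V) ⟩
    + (binomConv n (λ a b → V (suc a) b ℕ.+ V a (suc b)) ℕ.+ V 0 n)
      ≡⟨ pos-+ (binomConv n (λ a b → V (suc a) b ℕ.+ V a (suc b))) (V 0 n) ⟩
    + binomConv n (λ a b → ((c (suc a) ⊛ c b) ⊕ (c a ⊛ c (suc b))) k) + + V 0 n
      ≡⟨ cong₂ _+_ (trans (pos-binomConv n (λ a b → (c (suc a) ⊛ c b) ⊕ (c a ⊛ c (suc b))) k)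
                          (binomConvₛ-cong n (λ a b _ → pos-⊕-⊛ a b) k))
                   (cong +_ (c₀-⊛ (c n) k)) ⟩
    binomConvₛ n (λ a b → U (suc a) b ⊞ U a (suc b)) k + ĉ n k
      ≡⟨ cong (_+ ĉ n k) (binomConvₛ-cong n δ-U-rearranged k) ⟩
    binomConvₛ n (λ a b → δ (U a b) ⊞ N · shift (U a b)) k + ĉ n k
      ≡⟨ cong (_+ ĉ n k) (lincomb-⊞-· n w N (λ j → δ (Uⱼ j)) (λ j → shift (Uⱼ j)) k) ⟩
    lincomb n w (λ j → δ (Uⱼ j)) k + N * lincomb n w (λ j → shift (Uⱼ j)) k + ĉ n k
      ≡⟨ cong (_+ ĉ n k) (cong₂ (λ x y → x + N * y) (sym (δ-lincomb n w Uⱼ k)) (sym (shift-lincomb n w Uⱼ k))) ⟩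
    δ (binomConvₛ n U) k + N * shift (binomConvₛ n U) k + ĉ n k
      ≡⟨ cong (_+ ĉ n k) (cong₂ (λ x y → x + N * y) (sym (δ-cong (S-binomConvₛ n) k))
                                                    (sym (shift-cong (S-binomConvₛ n) k))) ⟩
    (δ (S n) ⊞ N · shift (S n) ⊞ ĉ n) k ∎
    where
    open ≡-Reasoning
    V : ℕ → ℕ → ℕ
    V a b = (c a ⊛ c b) k
    w : ℕ → ℤ
    w j = + (n C j)
    Uⱼ : ℕ → Seq
    Uⱼ j = U (n ∸ suc j) j
    N : ℤ
    N = + n + + n
    pos-⊕-⊛ : ∀ a b → toSeq ((c (suc a) ⊛ c b) ⊕ (c a ⊛ c (suc b))) ≗ U (suc a) b ⊞ U a (suc b)
    pos-⊕-⊛ a b i = trans (pos-+ ((c (suc a) ⊛ c b) i) ((c a ⊛ c (suc b)) i))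
                          (cong₂ _+_ (pos-⊛ (c (suc a)) (c b) i) (pos-⊛ (c a) (c (suc b)) i))
    δ-U-rearranged : ∀ a b → suc (a ℕ.+ b) ≡ n → U (suc a) b ⊞ U a (suc b) ≗ δ (U a b) ⊞ N · shift (U a b)
    δ-U-rearranged a b a+b+1≡n i =
      trans (identity (U (suc a) b i) (U a (suc b) i) (odd a + odd b) (shift (U a b) i))
            (cong₂ _+_ (sym (δ-U a b i)) (cong (_* shift (U a b) i) (odd-+-odd {a} {b} a+b+1≡n)))
      where
      identity : ∀ X Y M s → X + Y ≡ X + Y - M * s + M * s
      identity = solve-∀

  unfolded-ĉ-suc : ∀ a k → ĉ (suc a) k ≡ odd a * shift (ĉ a) k + (+ k * ĉ a k - (+ k - + 1) * shift (ĉ a) k)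
  unfolded-ĉ-suc a k = trans (ĉ-suc a k) (cong (λ t → odd a * shift (ĉ a) k + t) (δ-unfold (ĉ a) k))

  shift-ĉ-suc : ∀ a k → shift (ĉ (suc a)) k
    ≡ odd a * shift (shift (ĉ a)) k + ((+ k - + 1) * shift (ĉ a) k - (+ k - + 2) * shift (shift (ĉ a)) k)
  shift-ĉ-suc a zero    = vanish (odd a)
    where
    vanish : ∀ m → + 0 ≡ m * + 0 + ((+ 0 - + 1) * + 0 - (+ 0 - + 2) * + 0)
    vanish = solve-∀
  shift-ĉ-suc a (suc k) = trans (unfolded-ĉ-suc a k) (reindex (odd a) (+ k) (ĉ a k) (shift (ĉ a) k))
    where
    reindex : ∀ m K x y → m * y + (K * x - (K - + 1) * y) ≡ m * y + ((+ 1 + K - + 1) * x - (+ 1 + K - + 2) * y)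
    reindex = solve-∀

  S-closed : ∀ p → S (suc p) ≗ ĉ (suc p) ⊞ + suc p · ĉ p ⊟ + suc p · shift (ĉ p)
  S-closed zero k = begin
    S 1 k
      ≡⟨ cong +_ (trans (ℕ.*-identityˡ _) (c₀-⊛ (c 0) k)) ⟩
    ĉ 0 k
      ≡⟨ identity (ĉ 0 k) (shift (ĉ 0) k) ⟩
    + 1 * shift (ĉ 0) k + + 0 + + 1 * ĉ 0 k - + 1 * shift (ĉ 0) k
      ≡⟨ cong (λ t → t + + 1 * ĉ 0 k - + 1 * shift (ĉ 0) k) (sym ĉ₁) ⟩
    ĉ 1 k + + 1 * ĉ 0 k - + 1 * shift (ĉ 0) k ∎
    where
    open ≡-Reasoning
    ĉ₁ : ĉ 1 k ≡ + 1 * shift (ĉ 0) k + + 0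
    ĉ₁ = trans (ĉ-suc 0 k) (cong (λ t → + 1 * shift (ĉ 0) k + t) (δ-ĉ₀ k))
    identity : ∀ x s → x ≡ + 1 * s + + 0 + + 1 * x - + 1 * s
    identity = solve-∀
  S-closed (suc p) k = step (+ p) (+ k) (ĉ p k) (shift (ĉ p) k) (shift (shift (ĉ p)) k)
    (unfolded-ĉ-suc p k) (shift-ĉ-suc p k) (S-closed p k) (shifted-S-closed k) (unfolded-ĉ-suc (suc p) k)
    (trans (S-suc (suc p) k) (cong (λ t → t + N * shift (S (suc p)) k + ĉ (suc p) k) (δ-unfold (S (suc p)) k)))
    where
    N : ℤ
    N = + suc p + + suc p
    shifted-S-closed : ∀ i →
      shift (S (suc p)) i ≡ shift (ĉ (suc p)) i + + suc p * shift (ĉ p) i - + suc p * shift (shift (ĉ p)) i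
    shifted-S-closed zero    = vanish (+ suc p)
      where
      vanish : ∀ m → + 0 ≡ + 0 + m * + 0 - m * + 0
      vanish = solve-∀
    shifted-S-closed (suc i) = S-closed p i
    -- All six inputs are expressed through the coefficients of C_p at k, k - 1 and k - 2,
    -- so the step is a polynomial identity.
    step : ∀ P K A B C {c₁ c₁' s₁ s₁' c₂ s₂ : ℤ} →
      c₁  ≡ (P + P + + 1) * B + (K * A - (K - + 1) * B) →
      c₁' ≡ (P + P + + 1) * C + ((K - + 1) * B - (K - + 2) * C) →
      s₁  ≡ c₁ + (+ 1 + P) * A - (+ 1 + P) * B →
      s₁' ≡ c₁' + (+ 1 + P) * B - (+ 1 + P) * C →
      c₂  ≡ ((+ 1 + P) + (+ 1 + P) + + 1) * c₁' + (K * c₁ - (K - + 1) * c₁') →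
      s₂  ≡ K * s₁ - (K - + 1) * s₁' + ((+ 1 + P) + (+ 1 + P)) * s₁' + c₁ →
      s₂  ≡ c₂ + (+ 1 + (+ 1 + P)) * c₁ - (+ 1 + (+ 1 + P)) * c₁'
    step P K A B C refl refl refl refl refl refl = identity P K A B C
      where
      identity : ∀ P K A B C →
        let c₁  = (P + P + + 1) * B + (K * A - (K - + 1) * B)
            c₁' = (P + P + + 1) * C + ((K - + 1) * B - (K - + 2) * C)
            s₁  = c₁ + (+ 1 + P) * A - (+ 1 + P) * B
            s₁' = c₁' + (+ 1 + P) * B - (+ 1 + P) * C
        in K * s₁ - (K - + 1) * s₁' + ((+ 1 + P) + (+ 1 + P)) * s₁' + c₁
           ≡ ((+ 1 + P) + (+ 1 + P) + + 1) * c₁' + (K * c₁ - (K - + 1) * c₁')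
             + (+ 1 + (+ 1 + P)) * c₁ - (+ 1 + (+ 1 + P)) * c₁'
      identity = solve-∀

  binomConv-closed : ∀ p k →
    binomConv (suc p) (λ a b → (c a ⊛ c b) k) ℕ.+ suc p ℕ.* xmul (c p) k ≡ c (suc p) k ℕ.+ suc p ℕ.* c p k
  binomConv-closed p k = +-injective (begin
    + (T ℕ.+ suc p ℕ.* xmul (c p) k)
      ≡⟨ trans (pos-+ T (suc p ℕ.* xmul (c p) k)) (cong (λ t → S (suc p) k + t) (pos-* (suc p) (xmul (c p) k))) ⟩
    S (suc p) k + + suc p * toSeq (xmul (c p)) k
      ≡⟨ cong₂ (λ s x → s + + suc p * x) (S-closed p k) (sym (shift-toSeq (c p) k)) ⟩
    ĉ (suc p) k + + suc p * ĉ p k - + suc p * shift (ĉ p) k + + suc p * shift (ĉ p) k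
      ≡⟨ cancel (ĉ (suc p) k + + suc p * ĉ p k) (+ suc p * shift (ĉ p) k) ⟩
    ĉ (suc p) k + + suc p * ĉ p k
      ≡⟨ sym (trans (pos-+ (c (suc p) k) (suc p ℕ.* c p k)) (cong (λ t → ĉ (suc p) k + t) (pos-* (suc p) (c p k)))) ⟩
    + (c (suc p) k ℕ.+ suc p ℕ.* c p k) ∎)
    where
    open ≡-Reasoning
    T : ℕ
    T = binomConv (suc p) (λ a b → (c a ⊛ c b) k)
    cancel : ∀ x y → x - y + y ≡ x
    cancel = solve-∀

  recurrence : ∀ p k → c (suc p) k ≡ (scal (suc p) (xmul (c p))
    ⊕ ΣP p (λ r → scal (suc p C (suc p ∸ r ℕ.+ 1)) (c (suc p ∸ r) ⊛ c (r ∸ 1)))) k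
  recurrence p k = ℕ.+-cancelʳ-≡ (suc p ℕ.* c p k) _ _ (begin
    c (suc p) k ℕ.+ suc p ℕ.* c p k
      ≡⟨ sym (binomConv-closed p k) ⟩
    binomConv (suc p) V ℕ.+ X
      ≡⟨ cong (ℕ._+ X) (binomConv-last p V) ⟩
    T ℕ.+ suc p ℕ.* V 0 p ℕ.+ X
      ≡⟨ cong (λ v → T ℕ.+ suc p ℕ.* v ℕ.+ X) (c₀-⊛ (c p) k) ⟩
    T ℕ.+ suc p ℕ.* c p k ℕ.+ X
      ≡⟨ xy∙z≈zx∙y T _ X ⟩
    X ℕ.+ T ℕ.+ suc p ℕ.* c p k
      ≡⟨ cong (λ t → X ℕ.+ t ℕ.+ suc p ℕ.* c p k) T≡ΣP ⟩
    (scal (suc p) (xmul (c p)) ⊕ ΣP p F) k ℕ.+ suc p ℕ.* c p k ∎)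
    where
    open ≡-Reasoning
    V : ℕ → ℕ → ℕ
    V a b = (c a ⊛ c b) k
    F : ℕ → Poly
    F r = scal (suc p C (suc p ∸ r ℕ.+ 1)) (c (suc p ∸ r) ⊛ c (r ∸ 1))
    X T : ℕ
    X = suc p ℕ.* xmul (c p) k
    T = ℕSum.∑ p (λ j → (suc p C j) ℕ.* V (p ∸ j) j)
    T≡ΣP : T ≡ ΣP p F k
    T≡ΣP = trans (ℕSum.∑-cong p (λ j j<p → cong (ℕ._* V (p ∸ j) j) (sym ([1+p]C[p∸j+1]≡[1+p]Cj (ℕ.<⇒≤ j<p)))))
                 (sym (ΣP-∑ p F k))

module BoolFacts where

  open import Data.Bool.Base using (true; false; T)
  open import Data.Bool.Properties using (T-≡)
  open import Data.Empty using (⊥-elim)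
  open import Data.Nat.Base using (_<_; _≤_; _≡ᵇ_; _<ᵇ_; _≤ᵇ_)
  open import Data.Nat.Properties using (≡ᵇ⇒≡; ≡⇒≡ᵇ; <⇒<ᵇ; <ᵇ⇒<; ≤⇒≤ᵇ)
  open import Function.Bundles using (Equivalence)
  open import Relation.Nullary using (¬_)
  open import Relation.Binary.PropositionalEquality

  T⇒≡true : ∀ {b} → T b → b ≡ true
  T⇒≡true = Equivalence.to T-≡

  ≡true⇒T : ∀ {b} → b ≡ true → T b
  ≡true⇒T = Equivalence.from T-≡

  ≡ᵇ-refl : ∀ m → (m ≡ᵇ m) ≡ true
  ≡ᵇ-refl m = T⇒≡true (≡⇒≡ᵇ m m refl)

  ≢⇒≡ᵇ-false : ∀ {m n} → m ≢ n → (m ≡ᵇ n) ≡ false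
  ≢⇒≡ᵇ-false {m} {n} m≢n with m ≡ᵇ n in eq
  ... | true  = ⊥-elim (m≢n (≡ᵇ⇒≡ m n (≡true⇒T eq)))
  ... | false = refl

  ≡ᵇ-false⇒≢ : ∀ {m n} → (m ≡ᵇ n) ≡ false → n ≢ m
  ≡ᵇ-false⇒≢ {m} eq refl with trans (sym eq) (≡ᵇ-refl m)
  ... | ()

  <⇒<ᵇ-true : ∀ {m n} → m < n → (m <ᵇ n) ≡ true
  <⇒<ᵇ-true m<n = T⇒≡true (<⇒<ᵇ m<n)

  ≮⇒<ᵇ-false : ∀ {m n} → ¬ (m < n) → (m <ᵇ n) ≡ false
  ≮⇒<ᵇ-false {m} {n} m≮n with m <ᵇ n in eq
  ... | true  = ⊥-elim (m≮n (<ᵇ⇒< m n (≡true⇒T eq)))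
  ... | false = refl

  ≤⇒≤ᵇ-true : ∀ {m n} → m ≤ n → (m ≤ᵇ n) ≡ true
  ≤⇒≤ᵇ-true m≤n = T⇒≡true (≤⇒≤ᵇ m≤n)

module Counting where

  open import Data.Bool.Base using (Bool; if_then_else_)
  open import Data.Nat.Base using (suc; _+_)
  open import Data.List.Base using (List; []; _∷_; _++_; map; filterᵇ; length)
  open import Relation.Binary.PropositionalEquality

  private variable
    A B : Set

  count : (A → Bool) → List A → ℕ
  count p []       = 0
  count p (x ∷ xs) = if p x then suc (count p xs) else count p xs

  length-filterᵇ : ∀ (p : A → Bool) xs → length (filterᵇ p xs) ≡ count p xs
  length-filterᵇ p []       = refl
  length-filterᵇ p (x ∷ xs) with p x
  ... | Bool.true  = cong suc (length-filterᵇ p xs)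
  ... | Bool.false = length-filterᵇ p xs

  count-map : ∀ (p : B → Bool) (f : A → B) xs → count p (map f xs) ≡ count (λ x → p (f x)) xs
  count-map p f []       = refl
  count-map p f (x ∷ xs) rewrite count-map p f xs = refl

  count-++ : ∀ (p : A → Bool) xs ys → count p (xs ++ ys) ≡ count p xs + count p ys
  count-++ p []       ys = refl
  count-++ p (x ∷ xs) ys with p x
  ... | Bool.true  = cong suc (count-++ p xs ys)
  ... | Bool.false = count-++ p xs ys

module Insertions where

  open import Data.Bool.Base using (true; false; if_then_else_)
  open import Data.Nat.Base using (zero; suc; _+_; _∸_; _≤_; _<_; z≤n; s≤s; _≡ᵇ_; _<ᵇ_)
  open import Data.Nat.Properties
  open import Data.Product using (_×_; _,_; ∃₂; proj₁; proj₂)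
  open import Data.List.Base using (List; []; _∷_; _++_; [_]; map; concatMap; filter; length)
  open import Data.List.Properties using (∷-injective; length-++; filter-all; filter-reject; filter-++)
  open import Data.List.Membership.Propositional using (_∈_; find)
  open import Data.List.Membership.Propositional.Properties using (∈-map⁻; ∈-map⁺; ∈-concatMap⁻)
  open import Data.List.Relation.Unary.Any using (here; there)
  open import Data.List.Relation.Unary.All as All using (All; []; _∷_)
  import Data.List.Relation.Unary.All.Properties as All
  open import Data.List.Relation.Unary.Unique.Propositional using (Unique)
  import Data.List.Relation.Unary.Unique.Propositional.Properties as Unique
  open import Data.List.Relation.Unary.AllPairs using ([]; _∷_)
  open import Relation.Nullary using (¬_; ¬?)
  open import Relation.Binary.PropositionalEquality hiding ([_])
  open import Defs using (descents)
  open BoolFacts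
  open Counting

  insertions : ℕ → List ℕ → List (List ℕ)
  insertions m []      = (m ∷ m ∷ []) ∷ []
  insertions m (b ∷ σ) = (m ∷ m ∷ b ∷ σ) ∷ map (b ∷_) (insertions m σ)

  ∈-insertions⁺ : ∀ m u v → u ++ m ∷ m ∷ v ∈ insertions m (u ++ v)
  ∈-insertions⁺ m []      []      = here refl
  ∈-insertions⁺ m []      (b ∷ v) = here refl
  ∈-insertions⁺ m (a ∷ u) v       = there (∈-map⁺ (a ∷_) (∈-insertions⁺ m u v))

  ∈-insertions⁻ : ∀ m σ {w} → w ∈ insertions m σ → ∃₂ λ u v → σ ≡ u ++ v × w ≡ u ++ m ∷ m ∷ v
  ∈-insertions⁻ m []      (here refl) = [] , [] , refl , refl
  ∈-insertions⁻ m (b ∷ σ) (here refl) = [] , b ∷ σ , refl , refl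
  ∈-insertions⁻ m (b ∷ σ) (there w∈) with ∈-map⁻ (b ∷_) w∈
  ... | w' , w'∈ , refl with ∈-insertions⁻ m σ w'∈
  ... | u , v , refl , refl = b ∷ u , v , refl , refl

  erase : ℕ → List ℕ → List ℕ
  erase m = filter (λ a → ¬? (a ≟ m))

  erase-insertions : ∀ m σ {w} → All (_< m) σ → w ∈ insertions m σ → erase m w ≡ σ
  erase-insertions m σ σ<m w∈ with ∈-insertions⁻ m σ w∈
  ... | u , v , refl , refl with All.++⁻ u σ<m
  ... | u<m , v<m = begin
    erase m (u ++ m ∷ m ∷ v)         ≡⟨ filter-++ P? u (m ∷ m ∷ v) ⟩
    erase m u ++ erase m (m ∷ m ∷ v) ≡⟨ cong₂ _++_ (erased u<m) (skip (skip (erased v<m))) ⟩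
    u ++ v                           ∎
    where
    open ≡-Reasoning
    P? = λ a → ¬? (a ≟ m)
    erased : ∀ {xs} → All (_< m) xs → erase m xs ≡ xs
    erased xs<m = filter-all P? (All.map <⇒≢ xs<m)
    skip : ∀ {xs ys} → erase m xs ≡ ys → erase m (m ∷ xs) ≡ ys
    skip = trans (filter-reject P? (λ m≢m → m≢m refl))

  insertions-unique : ∀ m σ → All (_< m) σ → Unique (insertions m σ)
  insertions-unique m []      _           = [] ∷ []
  insertions-unique m (b ∷ σ) (b<m ∷ σ<m) =
    All.tabulate head-fresh ∷ Unique.map⁺ (λ eq → proj₂ (∷-injective eq)) (insertions-unique m σ σ<m)
    where
    head-fresh : ∀ {x} → x ∈ map (b ∷_) (insertions m σ) → (m ∷ m ∷ b ∷ σ) ≢ x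
    head-fresh x∈ eq with ∈-map⁻ (b ∷_) x∈
    ... | _ , _ , refl = <-irrefl (sym (proj₁ (∷-injective eq))) b<m

  concatMap-insertions-unique : ∀ m {xs} → Unique xs → All (All (_< m)) xs →
    Unique (concatMap (insertions m) xs)
  concatMap-insertions-unique m {[]}     _            _             = []
  concatMap-insertions-unique m {x ∷ xs} (x∉xs ∷ !xs) (x<m ∷ xs<m) =
    Unique.++⁺ (insertions-unique m x x<m) (concatMap-insertions-unique m !xs xs<m) disjoint
    where
    disjoint : ∀ {w} → ¬ (w ∈ insertions m x × w ∈ concatMap (insertions m) xs)
    disjoint (w∈x , w∈xs) with find (∈-concatMap⁻ (insertions m) {xs = xs} w∈xs)
    ... | y , y∈xs , w∈y = All.lookup x∉xs y∈xs
      (trans (sym (erase-insertions m x x<m w∈x)) (erase-insertions m y (All.lookup xs<m y∈xs) w∈y))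

  -- For a word with d descents and N insertion slots: a slot that is a descent keeps the
  -- number of descents, each of the other N - d slots raises it by one.
  insertionDescents : ℕ → ℕ → ℕ → ℕ
  insertionDescents d N k = (if d ≡ᵇ k then d else 0) + (if suc d ≡ᵇ k then N ∸ d else 0)

  descents-≤-length : ∀ a w → descents (a ∷ w) ≤ length w
  descents-≤-length a []      = z≤n
  descents-≤-length a (b ∷ w) with b <ᵇ a
  ... | true  = s≤s (descents-≤-length b w)
  ... | false = m≤n⇒m≤1+n (descents-≤-length b w)

  insertionDescents-rise : ∀ d N k → d ≤ N →
    (if suc d ≡ᵇ k then suc (insertionDescents d N k) else insertionDescents d N k)
      ≡ insertionDescents d (suc N) k
  insertionDescents-rise d N k d≤N with suc d ≡ᵇ k
  ... | true  = trans (sym (+-suc _ (N ∸ d))) (cong ((if d ≡ᵇ k then d else 0) +_) (sym (+-∸-assoc 1 d≤N)))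
  ... | false = refl

  insertionDescents-keep : ∀ d N k →
    (if d ≡ᵇ k then suc (insertionDescents d N k) else insertionDescents d N k)
      ≡ insertionDescents (suc d) (suc N) (suc k)
  insertionDescents-keep d N k with d ≡ᵇ k
  ... | true  = refl
  ... | false = refl

  count-insertions-descents : ∀ m a σ → a < m → All (_< m) σ → ∀ k →
    count (λ w → descents (a ∷ w ++ [ 0 ]) ≡ᵇ k) (insertions m σ)
      ≡ insertionDescents (descents (a ∷ σ ++ [ 0 ])) (suc (length σ)) k
  count-insertions-descents m a [] a<m [] k
    rewrite ≮⇒<ᵇ-false {m} {a} (λ m<a → <-asym m<a a<m) | ≮⇒<ᵇ-false {m} {m} (n≮n m)
          | <⇒<ᵇ-true {0} {m} (≤-<-trans z≤n a<m)
    = single a k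
    where
    single : ∀ a k → (if 1 ≡ᵇ k then 1 else 0) ≡ insertionDescents (descents (a ∷ 0 ∷ [])) 1 k
    single zero    zero                = refl
    single zero    (suc zero)          = refl
    single zero    (suc (suc k))       = refl
    single (suc a) zero                = refl
    single (suc a) (suc zero)          = refl
    single (suc a) (suc (suc zero))    = refl
    single (suc a) (suc (suc (suc k))) = refl
  count-insertions-descents m a (b ∷ σ) a<m (b<m ∷ σ<m) k
    rewrite ≮⇒<ᵇ-false {m} {a} (λ m<a → <-asym m<a a<m) | ≮⇒<ᵇ-false {m} {m} (n≮n m)
          | <⇒<ᵇ-true {b} {m} b<m
          | count-map (λ w → descents (a ∷ w ++ [ 0 ]) ≡ᵇ k) (b ∷_) (insertions m σ)
    with b <ᵇ a
  ... | false = trans (cong (λ z → if suc d ≡ᵇ k then suc z else z) (count-insertions-descents m b σ b<m σ<m k))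
                      (insertionDescents-rise d (suc (length σ)) k d≤1+length)
    where
    d = descents (b ∷ σ ++ [ 0 ])
    d≤1+length : d ≤ suc (length σ)
    d≤1+length = subst (d ≤_) (trans (length-++ σ) (+-comm (length σ) 1)) (descents-≤-length b (σ ++ [ 0 ]))
  ... | true with k
  ...   | zero   = none (insertions m σ)
    where
    none : ∀ ws → count (λ w → suc (descents (b ∷ w ++ [ 0 ])) ≡ᵇ 0) ws ≡ 0
    none []       = refl
    none (_ ∷ ws) = none ws
  ...   | suc k' = trans (cong (λ z → if d ≡ᵇ k' then suc z else z) (count-insertions-descents m b σ b<m σ<m k'))
                         (insertionDescents-keep d (suc (length σ)) k')
    where
    d = descents (b ∷ σ ++ [ 0 ])

module StirlingPermutations where

  open import Data.Bool.Base using (Bool; true; false; _∧_; if_then_else_)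
  open import Data.Bool.Properties using (∧-assoc; ∧-identityʳ)
  open import Data.Empty using (⊥-elim)
  open import Data.Nat.Base using (zero; suc; _+_; _*_; _≤_; _<_; z≤n; s≤s; _≡ᵇ_; _≤ᵇ_)
  open import Data.Nat.Properties
  open import Data.Product using (_×_; _,_; ∃; ∃₂; proj₁; proj₂)
  open import Data.List.Base using (List; []; _∷_; _++_; [_]; map; concatMap; upTo; length)
  open import Data.List.Properties using (∷-injective; length-++-sucʳ; upTo-∷ʳ; map-++)
  open import Data.List.Membership.Propositional using (_∈_; lose; find)
  open import Data.List.Membership.Propositional.Properties
  open import Data.List.Relation.Unary.Any using (here)
  open import Data.List.Relation.Unary.All as All using (All; []; _∷_)
  import Data.List.Relation.Unary.All.Properties as All
  open import Data.List.Relation.Unary.Unique.Propositional using (Unique)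
  import Data.List.Relation.Unary.Unique.Propositional.Properties as Unique
  open import Data.List.Relation.Unary.AllPairs using ([]; _∷_)
  open import Relation.Nullary using (¬_)
  open import Relation.Nullary.Decidable using (T?)
  open import Relation.Binary.PropositionalEquality hiding ([_])
  open import Defs
  open BoolFacts
  open Insertions using (insertions; ∈-insertions⁺; ∈-insertions⁻; concatMap-insertions-unique)
  open import Data.List.Relation.Binary.Permutation.Propositional using (_↭_)
  open import Data.List.Relation.Binary.BagAndSetEquality using (∼bag⇒↭)
  open import Data.List.Membership.Propositional.Properties.WithK using (unique∧set⇒bag)
  open import Function.Bundles using (mk⇔)

  Letter : ℕ → ℕ → Set
  Letter n a = 0 < a × a ≤ n

  ∈-letters⁻ : ∀ {n a} → a ∈ map suc (upTo n) → Letter n a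
  ∈-letters⁻ a∈ with ∈-map⁻ suc a∈
  ... | i , i∈ , refl = s≤s z≤n , ∈-upTo⁻ i∈

  ∈-letters⁺ : ∀ {n a} → Letter n a → a ∈ map suc (upTo n)
  ∈-letters⁺ {a = suc a} (_ , a<n) = ∈-map⁺ suc (∈-upTo⁺ a<n)

  ∈-words⁻ : ∀ n L {w} → w ∈ words n L → length w ≡ L × All (Letter n) w
  ∈-words⁻ n zero    (here refl) = refl , []
  ∈-words⁻ n (suc L) w∈ with find (∈-concatMap⁻ (λ a → map (a ∷_) (words n L)) {xs = map suc (upTo n)} w∈)
  ... | a , a∈ , w∈' with ∈-map⁻ (a ∷_) w∈'
  ... | w' , w'∈ , refl with ∈-words⁻ n L w'∈
  ... | length≡ , letters = cong suc length≡ , (∈-letters⁻ a∈ ∷ letters)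

  ∈-words⁺ : ∀ n L {w} → length w ≡ L → All (Letter n) w → w ∈ words n L
  ∈-words⁺ n zero    {[]}    refl [] = here refl
  ∈-words⁺ n (suc L) {a ∷ w} length≡ (a-letter ∷ letters) =
    ∈-concatMap⁺ (λ a → map (a ∷_) (words n L))
                 (lose (∈-letters⁺ a-letter) (∈-map⁺ (a ∷_) (∈-words⁺ n L (suc-injective length≡) letters)))

  prepend-unique : ∀ {as : List ℕ} {W : List (List ℕ)} → Unique as → Unique W →
    Unique (concatMap (λ a → map (a ∷_) W) as)
  prepend-unique {[]}     _          _  = []
  prepend-unique {a ∷ as} {W} (a∉as ∷ !as) !W =
    Unique.++⁺ (Unique.map⁺ (λ eq → proj₂ (∷-injective eq)) !W) (prepend-unique !as !W) disjoint
    where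
    disjoint : ∀ {w} → ¬ (w ∈ map (a ∷_) W × w ∈ concatMap (λ a → map (a ∷_) W) as)
    disjoint (w∈a , w∈as) with ∈-map⁻ (a ∷_) w∈a
    ... | _ , _ , refl with find (∈-concatMap⁻ (λ a → map (a ∷_) W) {xs = as} w∈as)
    ... | a' , a'∈as , w∈a' with ∈-map⁻ (a' ∷_) w∈a'
    ... | _ , _ , eq = All.lookup a∉as a'∈as (proj₁ (∷-injective eq))

  words-unique : ∀ n L → Unique (words n L)
  words-unique n zero    = [] ∷ []
  words-unique n (suc L) = prepend-unique (Unique.map⁺ suc-injective (Unique.upTo⁺ n)) (words-unique n L)

  ∧≡true : ∀ {a b} → (a ∧ b) ≡ true → a ≡ true × b ≡ true
  ∧≡true {true} {true} _ = refl , refl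

  occ-++ : ∀ i u v → occ i (u ++ v) ≡ occ i u + occ i v
  occ-++ i []      v = refl
  occ-++ i (b ∷ u) v with i ≡ᵇ b
  ... | true  = cong suc (occ-++ i u v)
  ... | false = occ-++ i u v

  occ-absent : ∀ m u → All (_< m) u → occ m u ≡ 0
  occ-absent m []      []          = refl
  occ-absent m (b ∷ u) (b<m ∷ u<m) rewrite ≢⇒≡ᵇ-false (>⇒≢ b<m) = occ-absent m u u<m

  occ≡0⇒All≢ : ∀ m u → occ m u ≡ 0 → All (_≢ m) u
  occ≡0⇒All≢ m []      _ = []
  occ≡0⇒All≢ m (b ∷ u) occ≡0 with m ≡ᵇ b in eq
  ... | true  = ⊥-elim (0≢1+n (sym occ≡0))
  ... | false = ≡ᵇ-false⇒≢ eq ∷ occ≡0⇒All≢ m u occ≡0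

  occ-insert : ∀ i m u v → i ≢ m → occ i (u ++ m ∷ m ∷ v) ≡ occ i (u ++ v)
  occ-insert i m u v i≢m rewrite occ-++ i u (m ∷ m ∷ v) | occ-++ i u v | ≢⇒≡ᵇ-false i≢m = refl

  occ-insert-self : ∀ m u v → occ m (u ++ m ∷ m ∷ v) ≡ occ m u + suc (suc (occ m v))
  occ-insert-self m u v rewrite occ-++ m u (m ∷ m ∷ v) | ≡ᵇ-refl m = refl

  allᵇ-++ : {A : Set} (p : A → Bool) (xs ys : List A) → allᵇ p (xs ++ ys) ≡ allᵇ p xs ∧ allᵇ p ys
  allᵇ-++ p []       ys = refl
  allᵇ-++ p (x ∷ xs) ys = trans (cong (p x ∧_) (allᵇ-++ p xs ys)) (sym (∧-assoc (p x) _ _))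

  eachTwice-suc : ∀ n w → eachTwice (suc n) w ≡ eachTwice n w ∧ (occ (suc n) w ≡ᵇ 2)
  eachTwice-suc n w = begin
    allᵇ twice (map suc (upTo (suc n)))
      ≡⟨ cong (λ l → allᵇ twice (map suc l)) (sym (upTo-∷ʳ n)) ⟩
    allᵇ twice (map suc (upTo n ++ [ n ]))
      ≡⟨ cong (allᵇ twice) (map-++ suc (upTo n) [ n ]) ⟩
    allᵇ twice (map suc (upTo n) ++ [ suc n ])
      ≡⟨ allᵇ-++ twice (map suc (upTo n)) [ suc n ] ⟩
    eachTwice n w ∧ (twice (suc n) ∧ true)
      ≡⟨ cong (eachTwice n w ∧_) (∧-identityʳ (twice (suc n))) ⟩
    eachTwice n w ∧ (occ (suc n) w ≡ᵇ 2) ∎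
    where
    open ≡-Reasoning
    twice : ℕ → Bool
    twice i = occ i w ≡ᵇ 2

  eachTwice-cong : ∀ n w w' → (∀ i → 0 < i → i ≤ n → occ i w ≡ occ i w') →
    eachTwice n w ≡ eachTwice n w'
  eachTwice-cong zero    w w' same = refl
  eachTwice-cong (suc n) w w' same = begin
    eachTwice (suc n) w
      ≡⟨ eachTwice-suc n w ⟩
    eachTwice n w ∧ (occ (suc n) w ≡ᵇ 2)
      ≡⟨ cong₂ _∧_ (eachTwice-cong n w w' (λ i 0<i i≤n → same i 0<i (m≤n⇒m≤1+n i≤n)))
                   (cong (_≡ᵇ 2) (same (suc n) (s≤s z≤n) ≤-refl)) ⟩
    eachTwice n w' ∧ (occ (suc n) w' ≡ᵇ 2)
      ≡⟨ sym (eachTwice-suc n w') ⟩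
    eachTwice (suc n) w' ∎
    where open ≡-Reasoning

  eachTwice-insert : ∀ n u v → eachTwice n (u ++ suc n ∷ suc n ∷ v) ≡ eachTwice n (u ++ v)
  eachTwice-insert n u v =
    eachTwice-cong n (u ++ suc n ∷ suc n ∷ v) (u ++ v) (λ i _ i≤n → occ-insert i (suc n) u v (<⇒≢ (s≤s i≤n)))

  anyᵇ-insert : ∀ m a u v → a < m →
    anyᵇ (λ b → a ≡ᵇ b) (u ++ m ∷ m ∷ v) ≡ anyᵇ (λ b → a ≡ᵇ b) (u ++ v)
  anyᵇ-insert m a []      v a<m rewrite ≢⇒≡ᵇ-false {a} {m} (<⇒≢ a<m) = refl
  anyᵇ-insert m a (x ∷ u) v a<m = cong (if a ≡ᵇ x then true else_) (anyᵇ-insert m a u v a<m)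

  allᵇ-beforeNext-insert : ∀ m a u v → a < m →
    allᵇ (λ b → a ≤ᵇ b) (beforeNext a (u ++ m ∷ m ∷ v)) ≡ allᵇ (λ b → a ≤ᵇ b) (beforeNext a (u ++ v))
  allᵇ-beforeNext-insert m a []      v a<m rewrite ≢⇒≡ᵇ-false {a} {m} (<⇒≢ a<m) | ≤⇒≤ᵇ-true (<⇒≤ a<m) = refl
  allᵇ-beforeNext-insert m a (x ∷ u) v a<m with a ≡ᵇ x
  ... | true  = refl
  ... | false = cong ((a ≤ᵇ x) ∧_) (allᵇ-beforeNext-insert m a u v a<m)

  anyᵇ-absent : ∀ m v → All (_< m) v → anyᵇ (λ b → m ≡ᵇ b) v ≡ false
  anyᵇ-absent m []      []          = refl
  anyᵇ-absent m (b ∷ v) (b<m ∷ v<m) rewrite ≢⇒≡ᵇ-false (>⇒≢ b<m) = anyᵇ-absent m v v<m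

  anyᵇ-present : ∀ m w → occ m w ≢ 0 → anyᵇ (λ b → m ≡ᵇ b) w ≡ true
  anyᵇ-present m []      occ≢0 = ⊥-elim (occ≢0 refl)
  anyᵇ-present m (b ∷ w) occ≢0 with m ≡ᵇ b
  ... | true  = refl
  ... | false = anyᵇ-present m w occ≢0

  stirlingGaps-insert : ∀ m u v → All (_< m) u → All (_< m) v →
    stirlingGaps (u ++ m ∷ m ∷ v) ≡ stirlingGaps (u ++ v)
  stirlingGaps-insert m []      v []          v<m rewrite ≡ᵇ-refl m | anyᵇ-absent m v v<m = refl
  stirlingGaps-insert m (a ∷ u) v (a<m ∷ u<m) v<m
    rewrite anyᵇ-insert m a u v a<m | allᵇ-beforeNext-insert m a u v a<m | stirlingGaps-insert m u v u<m v<m = refl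

  stirlingGaps-suffix : ∀ u w → stirlingGaps (u ++ w) ≡ true → stirlingGaps w ≡ true
  stirlingGaps-suffix []      w gaps = gaps
  stirlingGaps-suffix (a ∷ u) w gaps = stirlingGaps-suffix u w (proj₂ (∧≡true gaps))

  first-occurrence : ∀ m w k → occ m w ≡ suc k → ∃₂ λ u w' → w ≡ u ++ m ∷ w' × occ m u ≡ 0
  first-occurrence m []      k ()
  first-occurrence m (b ∷ w) k occ≡ with m ≡ᵇ b in eq
  ... | true  = [] , w , cong (_∷ w) (sym (≡ᵇ⇒≡ m b (≡true⇒T eq))) , refl
  ... | false with first-occurrence m w k occ≡
  ... | u , w' , refl , occ≡0 =
    b ∷ u , w' , refl , trans (cong (λ z → if z then suc (occ m u) else occ m u) eq) occ≡0

  record StirlingWord (n : ℕ) (w : List ℕ) : Set where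
    field
      length≡ : length w ≡ 2 * n
      letters : All (Letter n) w
      twice   : eachTwice n w ≡ true
      gaps    : stirlingGaps w ≡ true

  ∈-Q⁻ : ∀ n {w} → w ∈ Q n → StirlingWord n w
  ∈-Q⁻ n w∈ with ∈-filter⁻ (λ x → T? (isStirling n x)) {xs = words n (2 * n)} w∈
  ... | w∈words , stirling with ∈-words⁻ n (2 * n) w∈words | ∧≡true (T⇒≡true stirling)
  ... | length≡ , letters | twice , gaps =
    record { length≡ = length≡ ; letters = letters ; twice = twice ; gaps = gaps }

  ∈-Q⁺ : ∀ n {w} → StirlingWord n w → w ∈ Q n
  ∈-Q⁺ n s = ∈-filter⁺ (λ x → T? (isStirling n x)) (∈-words⁺ n (2 * n) length≡ letters)
                       (≡true⇒T (cong₂ _∧_ twice gaps))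
    where open StirlingWord s

  Q-unique : ∀ n → Unique (Q n)
  Q-unique n = Unique.filter⁺ (λ x → T? (isStirling n x)) (words-unique n (2 * n))

  length-insert : ∀ (m : ℕ) u v → length (u ++ m ∷ m ∷ v) ≡ suc (suc (length (u ++ v)))
  length-insert m u v = trans (length-++-sucʳ u m (m ∷ v)) (cong suc (length-++-sucʳ u m v))

  Letter<1+ : ∀ {n a} → Letter n a → a < suc n
  Letter<1+ (_ , a≤n) = s≤s a≤n

  StirlingWord-insert : ∀ n u v → StirlingWord n (u ++ v) →
    StirlingWord (suc n) (u ++ suc n ∷ suc n ∷ v)
  StirlingWord-insert n u v s = record
    { length≡ = trans (length-insert (suc n) u v) (trans (cong (suc ∘ suc) length≡) (sym (*-suc 2 n)))
    ; letters = All.++⁺ (All.map weaken u-letters) (top ∷ top ∷ All.map weaken v-letters)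
    ; twice   = begin
        eachTwice (suc n) w                  ≡⟨ eachTwice-suc n w ⟩
        eachTwice n w ∧ (occ (suc n) w ≡ᵇ 2) ≡⟨ cong₂ _∧_ (eachTwice-insert n u v) twiceTop ⟩
        eachTwice n (u ++ v) ∧ true          ≡⟨ cong (_∧ true) twice ⟩
        true                                 ∎
    ; gaps    = trans (stirlingGaps-insert (suc n) u v u<top v<top) gaps
    }
    where
    open StirlingWord s
    open ≡-Reasoning
    open import Function.Base using (_∘_)
    w = u ++ suc n ∷ suc n ∷ v
    u-letters = All.++⁻ˡ u letters
    v-letters = All.++⁻ʳ u letters
    u<top = All.map Letter<1+ u-letters
    v<top = All.map Letter<1+ v-letters
    weaken : ∀ {a} → Letter n a → Letter (suc n) a
    weaken (0<a , a≤n) = 0<a , m≤n⇒m≤1+n a≤n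
    top : Letter (suc n) (suc n)
    top = s≤s z≤n , ≤-refl
    twiceTop : (occ (suc n) w ≡ᵇ 2) ≡ true
    twiceTop rewrite occ-insert-self (suc n) u v | occ-absent (suc n) u u<top | occ-absent (suc n) v v<top = refl

  private
    m+2+n≡2⇒m≡n≡0 : ∀ a b → a + suc (suc b) ≡ 2 → a ≡ 0 × b ≡ 0
    m+2+n≡2⇒m≡n≡0 zero    zero    _  = refl , refl
    m+2+n≡2⇒m≡n≡0 zero    (suc b) ()
    m+2+n≡2⇒m≡n≡0 (suc zero)          b ()
    m+2+n≡2⇒m≡n≡0 (suc (suc zero))    b ()
    m+2+n≡2⇒m≡n≡0 (suc (suc (suc a))) b ()

  StirlingWord-remove : ∀ n u v → StirlingWord (suc n) (u ++ suc n ∷ suc n ∷ v) →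
    StirlingWord n (u ++ v)
  StirlingWord-remove n u v s = record
    { length≡ = suc-injective (suc-injective (trans (sym (length-insert (suc n) u v)) (trans length≡ (*-suc 2 n))))
    ; letters = All.++⁺ u-letters v-letters
    ; twice   = trans (sym (eachTwice-insert n u v)) (proj₁ twice-split)
    ; gaps    = trans (sym (stirlingGaps-insert (suc n) u v u<top v<top)) gaps
    }
    where
    open StirlingWord s
    w = u ++ suc n ∷ suc n ∷ v
    twice-split = ∧≡true (trans (sym (eachTwice-suc n w)) twice)
    top-absent : occ (suc n) u ≡ 0 × occ (suc n) v ≡ 0
    top-absent = m+2+n≡2⇒m≡n≡0 _ _
      (trans (sym (occ-insert-self (suc n) u v)) (≡ᵇ⇒≡ _ 2 (≡true⇒T (proj₂ twice-split))))
    lower : ∀ {a} → Letter (suc n) a × a ≢ suc n → Letter n a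
    lower ((0<a , a≤1+n) , a≢1+n) = 0<a , ≤-pred (≤∧≢⇒< a≤1+n a≢1+n)
    u-letters : All (Letter n) u
    u-letters = All.zipWith lower (All.++⁻ˡ u letters , occ≡0⇒All≢ (suc n) u (proj₁ top-absent))
    v-letters : All (Letter n) v
    v-letters with All.++⁻ʳ u letters
    ... | _ ∷ _ ∷ v-letters = All.zipWith lower (v-letters , occ≡0⇒All≢ (suc n) v (proj₂ top-absent))
    u<top = All.map Letter<1+ u-letters
    v<top = All.map Letter<1+ v-letters

  second-follows-first : ∀ m w → All (_≤ m) w → occ m w ≡ 1 → stirlingGaps (m ∷ w) ≡ true →
    ∃ λ v → w ≡ m ∷ v
  second-follows-first m []      _           ()     _
  second-follows-first m (b ∷ v) (b≤m ∷ _) occ≡1 gaps with m ≡ᵇ b in eq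
  ... | true  = v , cong (_∷ v) (sym (≡ᵇ⇒≡ m b (≡true⇒T eq)))
  ... | false = ⊥-elim (≡ᵇ-false⇒≢ eq (≤-antisym b≤m (≤ᵇ⇒≤ m b (≡true⇒T (proj₁ (∧≡true gap))))))
    where
    then-branch : ∀ {t x} → t ≡ true → (if t then x else true) ≡ true → x ≡ true
    then-branch refl x≡true = x≡true
    gap = then-branch (anyᵇ-present m v (λ occ≡0 → 0≢1+n (trans (sym occ≡0) occ≡1))) (proj₁ (∧≡true gaps))

  StirlingWord-occ-top : ∀ n {w} → StirlingWord (suc n) w → occ (suc n) w ≡ 2
  StirlingWord-occ-top n {w} s =
    ≡ᵇ⇒≡ _ 2 (≡true⇒T (proj₂ (∧≡true (trans (sym (eachTwice-suc n w)) (StirlingWord.twice s)))))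

  StirlingWord-split : ∀ n {w} → StirlingWord (suc n) w → ∃₂ λ u v → w ≡ u ++ suc n ∷ suc n ∷ v
  StirlingWord-split n {w} s with first-occurrence (suc n) w 1 (StirlingWord-occ-top n s)
  ... | u , w' , refl , occ-u≡0 with second-follows-first (suc n) w' w'≤top occ-w'≡1 gaps-from-top
    where
    open StirlingWord s
    w'≤top : All (_≤ suc n) w'
    w'≤top with All.++⁻ʳ u letters
    ... | _ ∷ w'-letters = All.map proj₂ w'-letters
    occ-w'≡1 : occ (suc n) w' ≡ 1
    occ-w'≡1 = suc-injective (begin
      suc (occ (suc n) w')
        ≡⟨ cong (λ t → t + suc (occ (suc n) w')) (sym occ-u≡0) ⟩
      occ (suc n) u + suc (occ (suc n) w')
        ≡⟨ cong (λ t → occ (suc n) u + (if t then suc (occ (suc n) w') else occ (suc n) w')) (sym (≡ᵇ-refl (suc n))) ⟩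
      occ (suc n) u + occ (suc n) (suc n ∷ w')
        ≡⟨ sym (occ-++ (suc n) u (suc n ∷ w')) ⟩
      occ (suc n) (u ++ suc n ∷ w')
        ≡⟨ StirlingWord-occ-top n s ⟩
      2 ∎)
      where open ≡-Reasoning
    gaps-from-top : stirlingGaps (suc n ∷ w') ≡ true
    gaps-from-top = stirlingGaps-suffix u (suc n ∷ w') gaps
  ... | v , refl = u , v , refl

  Q-suc↭insertions : ∀ n → Q (suc n) ↭ concatMap (insertions (suc n)) (Q n)
  Q-suc↭insertions n = ∼bag⇒↭ (unique∧set⇒bag (Q-unique (suc n)) insertions-unique′ (mk⇔ to from))
    where
    insertions-unique′ = concatMap-insertions-unique (suc n) (Q-unique n)
                           (All.tabulate (λ w∈ → All.map Letter<1+ (StirlingWord.letters (∈-Q⁻ n w∈))))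
    to : ∀ {w} → w ∈ Q (suc n) → w ∈ concatMap (insertions (suc n)) (Q n)
    to w∈ with StirlingWord-split n (∈-Q⁻ (suc n) w∈)
    ... | u , v , refl = ∈-concatMap⁺ (insertions (suc n)) (lose σ∈ (∈-insertions⁺ (suc n) u v))
      where
      σ∈ = ∈-Q⁺ n (StirlingWord-remove n u v (∈-Q⁻ (suc n) w∈))
    from : ∀ {w} → w ∈ concatMap (insertions (suc n)) (Q n) → w ∈ Q (suc n)
    from w∈ with find (∈-concatMap⁻ (insertions (suc n)) {xs = Q n} w∈)
    ... | σ , σ∈ , w∈σ with ∈-insertions⁻ (suc n) σ w∈σ
    ... | u , v , refl , refl = ∈-Q⁺ (suc n) (StirlingWord-insert n u v (∈-Q⁻ n σ∈))

module SecondOrderEulerianNumbers where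

  open import Data.Bool.Base using (Bool; true; false; if_then_else_)
  open import Data.Empty using (⊥-elim)
  open import Data.Nat.Base using (zero; suc; _+_; _*_; _∸_; _≤_; _≡ᵇ_; z≤n; s≤s)
  open import Data.Nat.Properties
  open import Data.Nat.Tactic.RingSolver using (solve-∀)
  open import Data.List.Base using (List; []; _∷_; _++_; [_]; map; concatMap; filterᵇ; length)
  open import Data.List.Properties using (length-++)
  open import Data.List.Membership.Propositional using (_∈_)
  open import Data.List.Relation.Unary.All as All using (All; []; _∷_)
  open import Data.List.Relation.Binary.Permutation.Propositional.Properties using (↭-length; filter-↭)
  open import Data.Nat.ListAction using (sum)
  open import Relation.Nullary.Decidable using (T?)
  open import Relation.Binary.PropositionalEquality hiding ([_])
  open import Defs
  open BoolFacts
  open Counting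
  open Insertions
  open StirlingPermutations

  indicator : Bool → ℕ
  indicator b = if b then 1 else 0

  count-∷ : ∀ {A : Set} (p : A → Bool) x xs → count p (x ∷ xs) ≡ indicator (p x) + count p xs
  count-∷ p x xs with p x
  ... | true  = refl
  ... | false = refl

  sum-count-identity : ∀ {A : Set} (f : A → ℕ) (p q : A → Bool) (k a N : ℕ) →
    ∀ xs → All (λ x → f x + k * indicator (p x) ≡ a * indicator (q x) + N * indicator (p x)) xs →
    sum (map f xs) + k * count p xs ≡ a * count q xs + N * count p xs
  sum-count-identity f p q k a N []       []                       =
    trans (*-zeroʳ k) (sym (cong₂ _+_ (*-zeroʳ a) (*-zeroʳ N)))
  sum-count-identity f p q k a N (x ∷ xs) (pointwise ∷ pointwises) = begin
    f x + sum (map f xs) + k * count p (x ∷ xs)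
      ≡⟨ cong (λ c → f x + sum (map f xs) + k * c) (count-∷ p x xs) ⟩
    f x + rest + k * (pₓ + cp)
      ≡⟨ split (f x) rest k pₓ cp ⟩
    (f x + k * pₓ) + (rest + k * cp)
      ≡⟨ cong₂ _+_ pointwise (sum-count-identity f p q k a N xs pointwises) ⟩
    (a * qₓ + N * pₓ) + (a * cq + N * cp)
      ≡⟨ merge a N pₓ qₓ cp cq ⟩
    a * (qₓ + cq) + N * (pₓ + cp)
      ≡⟨ sym (cong₂ (λ d c → a * d + N * c) (count-∷ q x xs) (count-∷ p x xs)) ⟩
    a * count q (x ∷ xs) + N * count p (x ∷ xs) ∎
    where
    open ≡-Reasoning
    rest = sum (map f xs)
    pₓ = indicator (p x)
    qₓ = indicator (q x)
    cp = count p xs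
    cq = count q xs
    split : ∀ y s k i c → y + s + k * (i + c) ≡ (y + k * i) + (s + k * c)
    split = solve-∀
    merge : ∀ a N i j c d → (a * j + N * i) + (a * d + N * c) ≡ a * (j + d) + N * (i + c)
    merge = solve-∀

  insertionDescents-zero : ∀ d N → insertionDescents d N 0 ≡ 0
  insertionDescents-zero zero    N = refl
  insertionDescents-zero (suc d) N = refl

  insertionDescents-suc : ∀ d N k → d ≤ N →
    insertionDescents d N (suc k) + k * indicator (d ≡ᵇ k)
      ≡ suc k * indicator (d ≡ᵇ suc k) + N * indicator (d ≡ᵇ k)
  insertionDescents-suc d N k d≤N with d ≡ᵇ k in d≡k | d ≡ᵇ suc k in d≡1+k
  ... | true  | true  =
    ⊥-elim (1+n≢n (trans (sym (≡ᵇ⇒≡ d (suc k) (≡true⇒T d≡1+k))) (≡ᵇ⇒≡ d k (≡true⇒T d≡k))))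
  ... | true  | false with ≡ᵇ⇒≡ d k (≡true⇒T d≡k)
  ...   | refl = trans (descend (N ∸ d) d) (trans (m∸n+n≡m d≤N) (sym (identity d N)))
    where
    descend : ∀ x d → 0 + x + d * 1 ≡ x + d
    descend = solve-∀
    identity : ∀ d N → suc d * 0 + N * 1 ≡ N
    identity = solve-∀
  insertionDescents-suc d N k d≤N | false | true with ≡ᵇ⇒≡ d (suc k) (≡true⇒T d≡1+k)
  ...   | refl = identity k N
    where
    identity : ∀ k N → suc k + 0 + k * 0 ≡ suc k * 1 + N * 0
    identity = solve-∀
  insertionDescents-suc d N k d≤N | false | false = vanish k N
    where
    vanish : ∀ k N → 0 + 0 + k * 0 ≡ suc k * 0 + N * 0
    vanish = solve-∀

  Ccoef≡count : ∀ n k → Ccoef n k ≡ count (λ σ → des σ ≡ᵇ k) (Q n)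
  Ccoef≡count zero    zero    = refl
  Ccoef≡count zero    (suc k) = refl
  Ccoef≡count (suc n) k       = length-filterᵇ _ (Q (suc n))

  des-≤ : ∀ n {σ} → σ ∈ Q n → des σ ≤ suc (2 * n)
  des-≤ n {σ} σ∈ = subst (des σ ≤_) length≡ (descents-≤-length 0 (σ ++ [ 0 ]))
    where
    length≡ : length (σ ++ [ 0 ]) ≡ suc (2 * n)
    length≡ = trans (length-++ σ) (trans (cong (_+ 1) (StirlingWord.length≡ (∈-Q⁻ n σ∈))) (+-comm (2 * n) 1))

  count-des-insertions : ∀ n xs → All (StirlingWord n) xs → ∀ k →
    count (λ w → des w ≡ᵇ k) (concatMap (insertions (suc n)) xs)
      ≡ sum (map (λ σ → insertionDescents (des σ) (suc (2 * n)) k) xs)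
  count-des-insertions n []       []       k = refl
  count-des-insertions n (σ ∷ xs) (s ∷ ss) k =
    trans (count-++ _ (insertions (suc n) σ) (concatMap (insertions (suc n)) xs))
          (cong₂ _+_ (trans (count-insertions-descents (suc n) 0 σ (s≤s z≤n) σ<top k)
                            (cong (λ L → insertionDescents (des σ) (suc L) k) (StirlingWord.length≡ s)))
                     (count-des-insertions n xs ss k))
    where
    σ<top = All.map Letter<1+ (StirlingWord.letters s)

  Ccoef-suc : ∀ n k → Ccoef (suc n) k ≡ sum (map (λ σ → insertionDescents (des σ) (suc (2 * n)) k) (Q n))
  Ccoef-suc n k = begin
    length (filterᵇ P (Q (suc n)))
      ≡⟨ ↭-length (filter-↭ (λ σ → T? (P σ)) (Q-suc↭insertions n)) ⟩
    length (filterᵇ P (concatMap (insertions (suc n)) (Q n)))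
      ≡⟨ length-filterᵇ P (concatMap (insertions (suc n)) (Q n)) ⟩
    count P (concatMap (insertions (suc n)) (Q n))
      ≡⟨ count-des-insertions n (Q n) (All.tabulate (∈-Q⁻ n)) k ⟩
    sum (map (λ σ → insertionDescents (des σ) (suc (2 * n)) k) (Q n)) ∎
    where
    open ≡-Reasoning
    P : List ℕ → Bool
    P σ = des σ ≡ᵇ k

  Ccoef-suc-zero : ∀ n → Ccoef (suc n) 0 ≡ 0
  Ccoef-suc-zero n = trans (Ccoef-suc n 0) (vanish (Q n))
    where
    vanish : ∀ xs → sum (map (λ σ → insertionDescents (des σ) (suc (2 * n)) 0) xs) ≡ 0
    vanish []       = refl
    vanish (σ ∷ xs) = cong₂ _+_ (insertionDescents-zero (des σ) (suc (2 * n))) (vanish xs)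

  Ccoef-suc-suc : ∀ n k →
    Ccoef (suc n) (suc k) + k * Ccoef n k ≡ suc k * Ccoef n (suc k) + (2 * n + 1) * Ccoef n k
  Ccoef-suc-suc n k rewrite Ccoef-suc n (suc k) | Ccoef≡count n k | Ccoef≡count n (suc k) | +-comm (2 * n) 1 =
    sum-count-identity _ (λ σ → des σ ≡ᵇ k) (λ σ → des σ ≡ᵇ suc k) k (suc k) (suc (2 * n)) (Q n)
      (All.tabulate (λ σ∈ → insertionDescents-suc _ _ k (des-≤ n σ∈)))

  Ccoef-secondOrderEulerian : SecondOrderEulerian Ccoef
  Ccoef-secondOrderEulerian = record
    { c₀-zero = refl
    ; c₀-suc  = λ _ → refl
    ; c-zero  = Ccoef-suc-zero
    ; c-suc   = Ccoef-suc-suc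
    }

open import Defs
open import Data.Nat using (ℕ; suc; _+_; _*_; _∸_; _≤_)
open import Data.Nat.Combinatorics using (_C_)
open import Data.Product using (_×_; _,_)
open import Relation.Binary.PropositionalEquality using (_≡_)

theorem2p1 : (n : ℕ) → 1 ≤ n →
  ((k : ℕ) → Ccoef n k ≡ (scal n (xmul (Ccoef (n ∸ 1)))
      ⊕ ΣP (n ∸ 1) (λ r → scal (n C (n ∸ r + 1)) (Ccoef (n ∸ r) ⊛ Ccoef (r ∸ 1)))) k)
  × (oddDF n ≡ n * oddDF (n ∸ 1)
      + Σℕ (n ∸ 1) (λ r → (n C (n ∸ r + 1)) * oddDF (n ∸ r) * oddDF (r ∸ 1)))
theorem2p1 (suc p) _ =
  ConvolutionRecurrence.recurrence SecondOrderEulerianNumbers.Ccoef-secondOrderEulerian p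
  , OddDoubleFactorial.oddDF-recurrence p
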